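{- Let $(\mathcal{A},w)$ be a nanoword over $\alpha$ and $a\in\alpha$. If $\tau(a)=a$, then $[a]_w \pmod 2\in(\mathbb{Z}/2\mathbb{Z})\pi$ is a homotopy invariant of $w$. If $\tau(a)\neq a$, then $[a]_w-[\tau(a)]_w\in\mathbb{Z}\pi$ is a homotopy invariant of $w$.
   Context: Fix a set $\alpha$ with involution $\tau$. An $\alpha$-alphabet is a set $\mathcal{A}$ with a map $A\mapsto|A|\in\alpha$. A nanoword over $\alpha$ is a pair $(\mathcal{A},w)$ with $\mathcal{A}$ a finite $\alpha$-alphabet and $w$ a word in $\mathcal{A}$ in which each letter occurs exactly twice. Homotopy of nanowords is the equivalence relation generated by isomorphisms (bijections of alphabets preserving $|\cdot|$ carrying one word letterwise to the other) and the moves and their inverses ($x,y,z,t$ words in the remaining letters): (1) $xAAy\mapsto xy$; (2) $xAByBAz\mapsto xyz$ if $|B|=\tau(|A|)$; (3) $xAByACzBCt\mapsto xBAyCAzCBt$ if $A,B,C$ distinct and $|A|=|B|=|C|$. Let $\pi$ be the multiplicative abelian group with generators $\{a\}_{a\in\alpha}$ and relations $a\,\tau(a)=1$ for $a\in\alpha$, and $\mathbb{Z}\pi$ its group ring. For $A,B\in\mathcal{A}$ set $n_w(A,B)=1$ if $w=\cdots A\cdots B\cdots A\cdots B\cdots$, $n_w(A,B)=-1$ if $w=\cdots B\cdots A\cdots B\cdots A\cdots$, and $n_w(A,B)=0$ otherwise. Put $[A]_w=\prod_{B\in\mathcal{A}}|B|^{n_w(A,B)}\in\pi$, $\mathcal{A}_w=\{A\in\mathcal{A}:[A]_w\neq1\}$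 and, for $a\in\alpha$, $[a]_w=\sum_{A\in\mathcal{A}_w,\,|A|=a}[A]_w\in\mathbb{Z}\pi$. -}

module Defs where

open import Data.Nat using (ℕ; _≟_)
open import Data.Nat as ℕ using ()
open import Data.Integer as ℤ using (ℤ; +_; -_; ∣_∣)
open import Data.Bool using (Bool; true; false; _xor_)
open import Data.List using (List; []; _∷_; _++_; [_]; length; filter; map; concatMap; deduplicate)
open import Data.List.Properties using (≡-dec)
open import Data.List.Membership.Propositional using (_∈_)
open import Data.List.Relation.Unary.Unique.Propositional using (Unique)
open import Data.List.Relation.Binary.Permutation.Propositional using (_↭_)
open import Data.Product using (_×_; _,_)
open import Data.Sum using (_⊎_)
open import Function using (_⇔_)
open import Relation.Nullary using (¬_; yes; no)
open import Relation.Nullary.Decidable using (_⊎-dec_)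
open import Relation.Binary.PropositionalEquality using (_≡_; _≢_)
open import Relation.Binary.Construct.Closure.Equivalence using (EqClosure)

-- Letters are natural numbers (an α-alphabet is a
-- finite set of letters together with a labelling map into α); the
-- alphabet of a nanoword is the set of letters occurring in its word.
-- Labels of letters not occurring in the word are irrelevant (the
-- isomorphism relation below ignores them).

record Nanoword (α : Set) : Set where
  field
    word  : List ℕ
    lab   : ℕ → α
    twice : ∀ A → A ∈ word → length (filter (A ≟_) word) ≡ 2

open Nanoword public

module _ {α : Set} (τ : α → α) where

  data Iso (u v : Nanoword α) : Set where
    iso : (f : ℕ → ℕ) → (∀ {m n} → f m ≡ f n → m ≡ n) →
          map f (word u) ≡ word v →
          (∀ A → A ∈ word u → lab v (f A) ≡ lab u A) →
          Iso u v

  data Move (u v : Nanoword α) : Set where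
    move1 : ∀ (x y : List ℕ) A →
            word u ≡ x ++ A ∷ A ∷ y → word v ≡ x ++ y →
            (∀ n → lab u n ≡ lab v n) → Move u v
    move2 : ∀ (x y z : List ℕ) A B →
            lab u B ≡ τ (lab u A) →
            word u ≡ x ++ A ∷ B ∷ y ++ B ∷ A ∷ z → word v ≡ x ++ y ++ z →
            (∀ n → lab u n ≡ lab v n) → Move u v
    move3 : ∀ (x y z t : List ℕ) A B C →
            A ≢ B → B ≢ C → A ≢ C →
            lab u A ≡ lab u B → lab u B ≡ lab u C →
            word u ≡ x ++ A ∷ B ∷ y ++ A ∷ C ∷ z ++ B ∷ C ∷ t →
            word v ≡ x ++ B ∷ A ∷ y ++ C ∷ A ∷ z ++ C ∷ B ∷ t →
            (∀ n → lab u n ≡ lab v n) → Move u v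

  data Step (u v : Nanoword α) : Set where
    isoStep  : Iso u v → Step u v
    moveStep : Move u v → Step u v

  Homotopic : Nanoword α → Nanoword α → Set
  Homotopic = EqClosure Step

  -- The group π = ⟨ a ∈ α | abelian, a τ(a) = 1 ⟩.
  -- Elements are represented by group words (letters a^{±1}), with
  -- equality the congruence generated by commutativity, free
  -- cancellation and the relations a τ(a) = 1.

  data Sign : Set where
    pos neg : Sign

  GWord : Set
  GWord = List (α × Sign)

  infix 4 _≈π_
  data _≈π_ : GWord → GWord → Set where
    ≈π-refl  : ∀ {g} → g ≈π g
    ≈π-sym   : ∀ {g h} → g ≈π h → h ≈π g
    ≈π-trans : ∀ {g h k} → g ≈π h → h ≈π k → g ≈π k
    ≈π-perm  : ∀ {g h} → g ↭ h → g ≈π h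
    ≈π-inv   : ∀ a → (a , pos) ∷ (a , neg) ∷ [] ≈π []
    ≈π-rel   : ∀ a → (a , pos) ∷ (τ a , pos) ∷ [] ≈π []
    ≈π-cong  : ∀ {g h} us vs → g ≈π h → us ++ g ++ vs ≈π us ++ h ++ vs

  1π : GWord
  1π = []

  -- Group rings R π for a coefficient ring R (only its additive
  -- structure matters here): formal finite sums Σ r_i g_i, with equality
  -- the congruence generated by reordering, merging equal group
  -- elements, dropping zero terms, and equality in π.

  module GroupRing (R : Set) (0R : R) (_+R_ : R → R → R) where

    Elem : Set
    Elem = List (R × GWord)

    infix 4 _≈_
    data _≈_ : Elem → Elem → Set where
      ≈-refl  : ∀ {s} → s ≈ s
      ≈-sym   : ∀ {s t} → s ≈ t → t ≈ s
      ≈-trans : ∀ {s t u} → s ≈ t → t ≈ u → s ≈ u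
      ≈-perm  : ∀ {s t} → s ↭ t → s ≈ t
      ≈-merge : ∀ c d g → (c , g) ∷ (d , g) ∷ [] ≈ (c +R d , g) ∷ []
      ≈-zero  : ∀ g → (0R , g) ∷ [] ≈ []
      ≈-grp   : ∀ c {g h} → g ≈π h → (c , g) ∷ [] ≈ (c , h) ∷ []
      ≈-cong  : ∀ {s t} us vs → s ≈ t → us ++ s ++ vs ≈ us ++ t ++ vs

  module ℤπ = GroupRing ℤ (+ 0) ℤ._+_
  module ℤ₂π = GroupRing Bool false _xor_

  negℤπ : ℤπ.Elem → ℤπ.Elem
  negℤπ = map (λ { (c , g) → (- c , g) })

  _−ℤπ_ : ℤπ.Elem → ℤπ.Elem → ℤπ.Elem
  s −ℤπ t = s ++ negℤπ t

  mod2 : ℤ → Bool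
  mod2 c with ∣ c ∣ ℕ.% 2
  ... | 0 = false
  ... | _ = true

  reduce₂ : ℤπ.Elem → ℤ₂π.Elem
  reduce₂ = map (λ { (c , g) → (mod2 c , g) })

  restrict : List ℕ → ℕ → ℕ → List ℕ
  restrict w A B = filter (λ X → (X ≟ A) ⊎-dec (X ≟ B)) w

  nw : List ℕ → ℕ → ℕ → ℤ
  nw w A B with ≡-dec _≟_ (restrict w A B) (A ∷ B ∷ A ∷ B ∷ [])
  ... | yes _ = + 1
  ... | no _ with ≡-dec _≟_ (restrict w A B) (B ∷ A ∷ B ∷ A ∷ [])
  ...   | yes _ = - (+ 1)
  ...   | no _  = + 0

  -- a^k for k ∈ {-1,0,1} (the only values of n_w)
  powπ : α → ℤ → GWord
  powπ a (+ 1)       = (a , pos) ∷ []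
  powπ a ℤ.-[1+ 0 ]  = (a , neg) ∷ []
  powπ a _           = []

  alphabet : Nanoword α → List ℕ
  alphabet u = deduplicate _≟_ (word u)

  bracketL : Nanoword α → ℕ → GWord
  bracketL u A = concatMap (λ B → powπ (lab u B) (nw (word u) A B)) (alphabet u)

  record Support (u : Nanoword α) (a : α) : Set where
    field
      letters  : List ℕ
      unique   : Unique letters
      complete : ∀ A → (A ∈ letters) ⇔ (A ∈ word u × lab u A ≡ a × ¬ (bracketL u A ≈π 1π))

  open Support public

  bracketα : (u : Nanoword α) (a : α) → Support u a → ℤπ.Elem
  bracketα u a S = map (λ A → (+ 1 , bracketL u A)) (letters S)

-- Write S_w for the sum of c(|X|)·[X]_w over the letters X of w with |X| ∈ {a, τ(a)} and [X]_w ≠ 1,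
-- where c(a) = 1 and c(τ(a)) = −1 (over ℤ/2ℤ when τ(a) = a, and then c = 1). Along an isomorphism or a
-- move the letters common to both words keep their brackets; move 1 deletes a letter A with [A] = 1, and
-- move 2 deletes letters A, B with |B| = τ(|A|) and [A] = [B], whose contributions cancel.
-- Triviality in π cannot be decided (α has no decidable equality), so S_w is generalised to states:
-- every letter is either marked (counted for a, counted for τ(a), or not counted, as its label and
-- bracket demand) or paired with a twin (τ-dual label, same bracket) against which it cancels. Every
-- step carries states to states of the same value, and every state has the value of any pair-free
-- one, such as the state described by the chosen enumerations of 𝒜_w.

module Submission where

open import Defs
open import Data.Nat using (ℕ; zero; suc; _≟_; _+_; _≤_; _<_; s≤s)
open import Data.Nat.Properties using (≤-refl; ≤-trans; n≤1+n; n≮n; +-suc; suc-injective)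
open import Data.Integer as ℤ using (ℤ; +_; -[1+_])
open import Data.Bool using (Bool; true; false; _xor_)
open import Data.List using (List; []; _∷_; [_]; _++_; length; filter; map; concatMap)
open import Data.List.Properties
  using (++-assoc; ++-identityʳ; filter-accept; filter-reject; filter-all; filter-++; filter-none; filter-some;
         length-++; ≡-dec; ∷-injective; map-injective; map-++; concatMap-map; concatMap-pure; map-∘)
open import Data.List.Membership.Propositional using (_∈_; _∉_)
open import Data.List.Membership.Propositional.Properties
  using (∈-filter⁺; ∈-filter⁻; ∈-deduplicate⁺; ∈-deduplicate⁻; ∈-map⁺; ∈-map⁻; ∈-++⁺ˡ; ∈-++⁺ʳ; ∈-++⁻)
open import Data.List.Membership.DecPropositional _≟_ using (_∈?_)
open import Data.List.Relation.Unary.Any using (here; there)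
open import Data.List.Relation.Unary.All using (All; []; _∷_)
open import Data.List.Relation.Unary.AllPairs using ([]; _∷_)
open import Data.List.Relation.Unary.Unique.Propositional using (Unique)
open import Data.List.Relation.Unary.Unique.Propositional.Properties using (filter⁺; map⁺; Unique[x∷xs]⇒x∉xs)
open import Data.List.Relation.Unary.Unique.DecPropositional.Properties _≟_ using (deduplicate-!)
import Data.List.Relation.Binary.Permutation.Propositional as Perm
open import Data.List.Relation.Binary.Permutation.Propositional using (_↭_; ↭-sym; ↭-trans; ↭-refl; ↭-reflexive; prep; swap)
open import Data.List.Relation.Binary.Permutation.Propositional.Properties using (++⁺ˡ; shifts; ↭-length; ∈-resp-↭)
open import Data.Product using (_×_; _,_; proj₁; proj₂; Σ; ∃-syntax)
open import Data.Sum using (_⊎_; inj₁; inj₂; [_,_]′)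
open import Data.Empty using (⊥; ⊥-elim)
open import Function.Bundles using (Equivalence)
open import Relation.Nullary using (¬_; ¬?; Dec; yes; no)
open import Relation.Nullary.Decidable using (_⊎-dec_)
open import Relation.Binary.PropositionalEquality
  using (_≡_; _≢_; refl; sym; trans; cong; cong₂; subst; subst₂; ≢-sym; module ≡-Reasoning)
open import Relation.Binary.Construct.Closure.ReflexiveTransitive using (ε; _◅_)
open import Relation.Binary.Construct.Closure.Symmetric using (fwd; bwd)

-- Sums indexed by duplicate-free lists of letters

remove : ℕ → List ℕ → List ℕ
remove x = filter (λ y → ¬? (y ≟ x))

∈-remove⁻ : ∀ {x z} L → z ∈ remove x L → z ∈ L × z ≢ x
∈-remove⁻ {x} L = ∈-filter⁻ (λ y → ¬? (y ≟ x))

∈-remove⁺ : ∀ {x z L} → z ∈ L → z ≢ x → z ∈ remove x L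
∈-remove⁺ {x} = ∈-filter⁺ (λ y → ¬? (y ≟ x))

remove-unique : ∀ {x L} → Unique L → Unique (remove x L)
remove-unique {x} = filter⁺ (λ y → ¬? (y ≟ x))

remove-∉ : ∀ {x} L → x ∉ L → remove x L ≡ L
remove-∉ {x} L x∉L = filter-all (λ y → ¬? (y ≟ x)) (all L x∉L)
  where
  all : ∀ L → x ∉ L → All (_≢ x) L
  all []      _   = []
  all (y ∷ L) x∉ = (λ y≡x → x∉ (here (sym y≡x))) ∷ all L (λ x∈ → x∉ (there x∈))

↭-remove : ∀ {x L} → Unique L → x ∈ L → L ↭ x ∷ remove x L
↭-remove {x} {y ∷ L} u@(_ ∷ uL) (here refl) =
  prep y (↭-reflexive (sym (trans (filter-reject (λ y → ¬? (y ≟ x)) (λ x≢x → x≢x refl))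
                                  (remove-∉ L (Unique[x∷xs]⇒x∉xs u)))))
↭-remove {x} {y ∷ L} u@(_ ∷ uL) (there x∈L) with y ≟ x
... | yes refl = ⊥-elim (Unique[x∷xs]⇒x∉xs u x∈L)
... | no y≢x = ↭-trans (prep y (↭-remove uL x∈L))
                 (↭-trans (swap y x ↭-refl) (prep x (↭-reflexive (sym (filter-accept (λ y → ¬? (y ≟ x)) y≢x)))))

concatMap-singleton : ∀ {A B : Set} (f : A → B) L → concatMap (λ x → f x ∷ []) L ≡ map f L
concatMap-singleton f L = trans (sym (concatMap-map [_] f L)) (concatMap-pure (map f L))

record ListCongruence (T : Set) : Set₁ where
  infix 4 _∼_
  field
    _∼_      : List T → List T → Set
    ∼-refl   : ∀ {s} → s ∼ s
    ∼-sym    : ∀ {s t} → s ∼ t → t ∼ s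
    ∼-trans  : ∀ {s t u} → s ∼ t → t ∼ u → s ∼ u
    ↭⇒∼      : ∀ {s t} → s ↭ t → s ∼ t
    ∼-inside : ∀ {s t} us vs → s ∼ t → us ++ s ++ vs ∼ us ++ t ++ vs

module ListCongruenceProperties {T : Set} (C : ListCongruence T) where
  open ListCongruence C

  ≡⇒∼ : ∀ {s t} → s ≡ t → s ∼ t
  ≡⇒∼ refl = ∼-refl

  ++-congˡ : ∀ {s t} u → s ∼ t → u ++ s ∼ u ++ t
  ++-congˡ {s} {t} u s∼t =
    subst₂ _∼_ (cong (u ++_) (++-identityʳ s)) (cong (u ++_) (++-identityʳ t)) (∼-inside u [] s∼t)

  ++-congʳ : ∀ {s t} u → s ∼ t → s ++ u ∼ t ++ u
  ++-congʳ u = ∼-inside [] u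

  ++-cong : ∀ {s s′ t t′} → s ∼ s′ → t ∼ t′ → s ++ t ∼ s′ ++ t′
  ++-cong {s′ = s′} {t = t} p q = ∼-trans (++-congʳ t p) (++-congˡ s′ q)

  concatMap-↭ : (f : ℕ → List T) → ∀ {L₁ L₂} → L₁ ↭ L₂ → concatMap f L₁ ↭ concatMap f L₂
  concatMap-↭ f Perm.refl        = ↭-refl
  concatMap-↭ f (prep x p)       = ++⁺ˡ (f x) (concatMap-↭ f p)
  concatMap-↭ f (swap x y p)     = ↭-trans (++⁺ˡ (f x) (++⁺ˡ (f y) (concatMap-↭ f p))) (shifts (f x) (f y))
  concatMap-↭ f (Perm.trans p q) = ↭-trans (concatMap-↭ f p) (concatMap-↭ f q)

  concatMap-++ : (f g : ℕ → List T) → ∀ L →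
                 concatMap (λ x → f x ++ g x) L ↭ concatMap f L ++ concatMap g L
  concatMap-++ f g []      = ↭-refl
  concatMap-++ f g (x ∷ L) =
    ↭-trans (↭-reflexive (++-assoc (f x) (g x) _))
    (↭-trans (++⁺ˡ (f x) (++⁺ˡ (g x) (concatMap-++ f g L)))
    (↭-trans (++⁺ˡ (f x) (shifts (g x) (concatMap f L)))
             (↭-reflexive (sym (++-assoc (f x) (concatMap f L) _)))))

  concatMap-cong : (f g : ℕ → List T) → ∀ L → (∀ x → x ∈ L → f x ∼ g x) → concatMap f L ∼ concatMap g L
  concatMap-cong f g []      _ = ∼-refl
  concatMap-cong f g (x ∷ L) h = ++-cong (h x (here refl)) (concatMap-cong f g L (λ y y∈ → h y (there y∈)))

  concatMap-∼[] : (f : ℕ → List T) → ∀ L → (∀ x → x ∈ L → f x ∼ []) → concatMap f L ∼ []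
  concatMap-∼[] f []      _ = ∼-refl
  concatMap-∼[] f (x ∷ L) h = ++-cong (h x (here refl)) (concatMap-∼[] f L (λ y y∈ → h y (there y∈)))

  concatMap-cong-overlap :
    (f g : ℕ → List T) → ∀ L₁ L₂ → Unique L₁ → Unique L₂ →
    (∀ x → x ∈ L₁ → x ∈ L₂ → f x ∼ g x) →
    (∀ x → x ∈ L₁ → x ∉ L₂ → f x ∼ []) →
    (∀ x → x ∈ L₂ → x ∉ L₁ → g x ∼ []) →
    concatMap f L₁ ∼ concatMap g L₂
  concatMap-cong-overlap f g [] L₂ _ _ _ _ only₂ = ∼-sym (concatMap-∼[] g L₂ (λ x x∈ → only₂ x x∈ (λ ())))
  concatMap-cong-overlap f g (x ∷ L₁) L₂ u₁@(_ ∷ uL₁) u₂ both only₁ only₂ with x ∈? L₂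
  ... | yes x∈L₂ =
    ∼-trans (++-cong (both x (here refl) x∈L₂) rest) (↭⇒∼ (↭-sym (concatMap-↭ g (↭-remove u₂ x∈L₂))))
    where
    rest = concatMap-cong-overlap f g L₁ (remove x L₂) uL₁ (remove-unique u₂)
      (λ y y∈L₁ y∈r → both y (there y∈L₁) (proj₁ (∈-remove⁻ L₂ y∈r)))
      (λ y y∈L₁ y∉r → only₁ y (there y∈L₁)
         (λ y∈L₂ → y∉r (∈-remove⁺ y∈L₂ (λ { refl → Unique[x∷xs]⇒x∉xs u₁ y∈L₁ }))))
      (λ y y∈r y∉L₁ → only₂ y (proj₁ (∈-remove⁻ L₂ y∈r))
         λ { (here refl) → proj₂ (∈-remove⁻ L₂ y∈r) refl ; (there y∈) → y∉L₁ y∈ })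
  ... | no x∉L₂ =
    ++-cong (only₁ x (here refl) x∉L₂)
      (concatMap-cong-overlap f g L₁ L₂ uL₁ u₂
        (λ y y∈L₁ → both y (there y∈L₁))
        (λ y y∈L₁ → only₁ y (there y∈L₁))
        (λ y y∈L₂ y∉L₁ → only₂ y y∈L₂ λ { (here refl) → x∉L₂ y∈L₂ ; (there y∈) → y∉L₁ y∈ }))

  concatMap-reindex :
    (h : ℕ → List T) (f : ℕ → ℕ) → (∀ {m n} → f m ≡ f n → m ≡ n) → ∀ L₁ L₂ → Unique L₁ → Unique L₂ →
    (∀ x → x ∈ L₁ → f x ∈ L₂) → (∀ y → y ∈ L₂ → ∃[ x ] x ∈ L₁ × y ≡ f x) →
    concatMap h L₂ ∼ concatMap (λ x → h (f x)) L₁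
  concatMap-reindex h f inj L₁ L₂ u₁ u₂ f∈ onto =
    ∼-trans (concatMap-cong-overlap h h L₂ (map f L₁) u₂ (map⁺ inj u₁) (λ _ _ _ → ∼-refl)
               (λ y y∈L₂ y∉ → ⊥-elim (y∉ (let x , x∈ , y≡ = onto y y∈L₂ in subst (_∈ map f L₁) (sym y≡) (∈-map⁺ f x∈))))
               (λ y y∈ y∉L₂ → ⊥-elim (y∉L₂ (let x , x∈ , y≡ = ∈-map⁻ f y∈ in subst (_∈ L₂) (sym y≡) (f∈ x x∈)))))
            (≡⇒∼ (concatMap-map h f L₁))

  outside : List ℕ → (ℕ → List T) → ℕ → List T
  outside E f x with x ∈? E
  ... | yes _ = []
  ... | no _  = f x

  outside-∉ : ∀ E f {x} → x ∉ E → outside E f x ≡ f x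
  outside-∉ E f {x} x∉E with x ∈? E
  ... | yes x∈E = ⊥-elim (x∉E x∈E)
  ... | no _    = refl

  outside-∈ : ∀ E f {x} → x ∈ E → outside E f x ≡ []
  outside-∈ E f {x} x∈E with x ∈? E
  ... | yes _   = refl
  ... | no x∉E = ⊥-elim (x∉E x∈E)

  concatMap-split : (f : ℕ → List T) → ∀ E L → Unique E → Unique L → (∀ x → x ∈ E → x ∈ L) →
                    concatMap f L ∼ concatMap f E ++ concatMap (outside E f) L
  concatMap-split f E L uE uL E⊆L =
    ∼-trans (concatMap-cong f (λ x → inside x ++ outside E f x) L split)
    (∼-trans (↭⇒∼ (concatMap-++ inside (outside E f) L))
             (++-congʳ _ (concatMap-cong-overlap inside f L E uL uE
                (λ x _ x∈E → ≡⇒∼ (inside-∈ x∈E))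
                (λ x _ x∉E → ≡⇒∼ (inside-∉ x∉E))
                (λ x x∈E x∉L → ⊥-elim (x∉L (E⊆L x x∈E))))))
    where
    inside : ℕ → List T
    inside x with x ∈? E
    ... | yes _ = f x
    ... | no _  = []
    inside-∈ : ∀ {x} → x ∈ E → inside x ≡ f x
    inside-∈ {x} x∈E with x ∈? E
    ... | yes _   = refl
    ... | no x∉E = ⊥-elim (x∉E x∈E)
    inside-∉ : ∀ {x} → x ∉ E → inside x ≡ []
    inside-∉ {x} x∉E with x ∈? E
    ... | yes x∈E = ⊥-elim (x∉E x∈E)
    ... | no _    = refl
    split : ∀ x → x ∈ L → f x ∼ inside x ++ outside E f x
    split x _ with x ∈? E
    ... | yes _ = ≡⇒∼ (sym (++-identityʳ (f x)))
    ... | no _  = ∼-refl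

  concatMap-cong-except :
    (f g : ℕ → List T) → ∀ L₁ L₂ E₁ E₂ → Unique L₁ → Unique L₂ → Unique E₁ → Unique E₂ →
    (∀ x → x ∈ E₁ → x ∈ L₁) → (∀ x → x ∈ E₂ → x ∈ L₂) →
    concatMap f E₁ ∼ concatMap g E₂ →
    (∀ x → x ∈ L₁ → x ∈ L₂ → outside E₁ f x ∼ outside E₂ g x) →
    (∀ x → x ∈ L₁ → x ∉ L₂ → outside E₁ f x ∼ []) →
    (∀ x → x ∈ L₂ → x ∉ L₁ → outside E₂ g x ∼ []) →
    concatMap f L₁ ∼ concatMap g L₂
  concatMap-cong-except f g L₁ L₂ E₁ E₂ u₁ u₂ uE₁ uE₂ E₁⊆ E₂⊆ onE both only₁ only₂ =
    ∼-trans (concatMap-split f E₁ L₁ uE₁ u₁ E₁⊆)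
    (∼-trans (++-cong onE (concatMap-cong-overlap (outside E₁ f) (outside E₂ g) L₁ L₂ u₁ u₂ both only₁ only₂))
             (∼-sym (concatMap-split g E₂ L₂ uE₂ u₂ E₂⊆)))

-- Restrictions of a word to two letters

head-≡ : ∀ {a b : ℕ} {l l′ : List ℕ} → a ∷ l ≡ b ∷ l′ → a ≡ b
head-≡ e = proj₁ (∷-injective e)

second-≡ : ∀ {a b c d : ℕ} {l l′ : List ℕ} → a ∷ b ∷ l ≡ c ∷ d ∷ l′ → b ≡ d
second-≡ e = head-≡ (proj₂ (∷-injective e))

third-≡ : ∀ {a b c d e f : ℕ} {l l′ : List ℕ} → a ∷ b ∷ c ∷ l ≡ d ∷ e ∷ f ∷ l′ → c ≡ f
third-≡ e = second-≡ (proj₂ (∷-injective e))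

crossing : List ℕ → ℕ → ℕ → ℤ
crossing r A B with ≡-dec _≟_ r (A ∷ B ∷ A ∷ B ∷ [])
... | yes _ = + 1
... | no _ with ≡-dec _≟_ r (B ∷ A ∷ B ∷ A ∷ [])
...   | yes _ = -[1+ 0 ]
...   | no _  = + 0

crossing-positive : ∀ {A B} → crossing (A ∷ B ∷ A ∷ B ∷ []) A B ≡ + 1
crossing-positive {A} {B} with ≡-dec _≟_ (A ∷ B ∷ A ∷ B ∷ []) (A ∷ B ∷ A ∷ B ∷ [])
... | yes _ = refl
... | no ≢ = ⊥-elim (≢ refl)

crossing-negative : ∀ {A B} → A ≢ B → crossing (B ∷ A ∷ B ∷ A ∷ []) A B ≡ -[1+ 0 ]
crossing-negative {A} {B} A≢B with ≡-dec _≟_ (B ∷ A ∷ B ∷ A ∷ []) (A ∷ B ∷ A ∷ B ∷ [])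
... | yes e = ⊥-elim (A≢B (sym (head-≡ e)))
... | no _ with ≡-dec _≟_ (B ∷ A ∷ B ∷ A ∷ []) (B ∷ A ∷ B ∷ A ∷ [])
...   | yes _ = refl
...   | no ≢ = ⊥-elim (≢ refl)

crossing-zero : ∀ {r A B} → r ≢ A ∷ B ∷ A ∷ B ∷ [] → r ≢ B ∷ A ∷ B ∷ A ∷ [] → crossing r A B ≡ + 0
crossing-zero {r} {A} {B} ≢₁ ≢₂ with ≡-dec _≟_ r (A ∷ B ∷ A ∷ B ∷ [])
... | yes e = ⊥-elim (≢₁ e)
... | no _ with ≡-dec _≟_ r (B ∷ A ∷ B ∷ A ∷ [])
...   | yes e = ⊥-elim (≢₂ e)
...   | no _  = refl

crossing-map : (σ : ℕ → ℕ) → (∀ {m n} → σ m ≡ σ n → m ≡ n) → ∀ r A B →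
               crossing (map σ r) (σ A) (σ B) ≡ crossing r A B
crossing-map σ inj r A B
  with ≡-dec _≟_ (map σ r) (σ A ∷ σ B ∷ σ A ∷ σ B ∷ []) | ≡-dec _≟_ r (A ∷ B ∷ A ∷ B ∷ [])
... | yes _ | yes _    = refl
... | yes e | no ≢     = ⊥-elim (≢ (map-injective inj e))
... | no ≢  | yes refl = ⊥-elim (≢ refl)
... | no _  | no _
  with ≡-dec _≟_ (map σ r) (σ B ∷ σ A ∷ σ B ∷ σ A ∷ []) | ≡-dec _≟_ r (B ∷ A ∷ B ∷ A ∷ [])
...   | yes _ | yes _    = refl
...   | yes e | no ≢     = ⊥-elim (≢ (map-injective inj e))
...   | no ≢  | yes refl = ⊥-elim (≢ refl)
...   | no _  | no _     = refl

OneOf : ℕ → ℕ → ℕ → Set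
OneOf X Z Y = Y ≡ X ⊎ Y ≡ Z

oneOf? : ∀ X Z Y → Dec (OneOf X Z Y)
oneOf? X Z Y = (Y ≟ X) ⊎-dec (Y ≟ Z)

transpose : ℕ → ℕ → ℕ → ℕ
transpose A B n with n ≟ A
... | yes _ = B
... | no _ with n ≟ B
...   | yes _ = A
...   | no _  = n

transpose-left : ∀ A B → transpose A B A ≡ B
transpose-left A B with A ≟ A
... | yes _ = refl
... | no A≢A = ⊥-elim (A≢A refl)

transpose-right : ∀ A B → transpose A B B ≡ A
transpose-right A B with B ≟ A
... | yes B≡A = B≡A
... | no _ with B ≟ B
...   | yes _ = refl
...   | no B≢B = ⊥-elim (B≢B refl)

transpose-other : ∀ A B n → n ≢ A → n ≢ B → transpose A B n ≡ n
transpose-other A B n n≢A n≢B with n ≟ A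
... | yes n≡A = ⊥-elim (n≢A n≡A)
... | no _ with n ≟ B
...   | yes n≡B = ⊥-elim (n≢B n≡B)
...   | no _    = refl

transpose-involutive : ∀ A B n → transpose A B (transpose A B n) ≡ n
transpose-involutive A B n with n ≟ A
... | yes refl = transpose-right n B
... | no n≢A with n ≟ B
...   | yes refl = transpose-left A n
...   | no n≢B  = transpose-other A B n n≢A n≢B

transpose-injective : ∀ A B {m n} → transpose A B m ≡ transpose A B n → m ≡ n
transpose-injective A B {m} {n} e =
  trans (sym (transpose-involutive A B m)) (trans (cong (transpose A B) e) (transpose-involutive A B n))

map-transpose-fresh : ∀ A B l → A ∉ l → B ∉ l → map (transpose A B) l ≡ l
map-transpose-fresh A B []      _   _   = refl
map-transpose-fresh A B (n ∷ l) A∉ B∉ =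
  cong₂ _∷_ (transpose-other A B n (λ { refl → A∉ (here refl) }) (λ { refl → B∉ (here refl) }))
            (map-transpose-fresh A B l (λ m → A∉ (there m)) (λ m → B∉ (there m)))

-- Statuses of letters

data Mark : Set where
  onA onT off : Mark

data Status : Set where
  marked : Mark → Status
  paired : ℕ → Status

paired-injective : ∀ {m n} → paired m ≡ paired n → m ≡ n
paired-injective refl = refl

relabel : (ℕ → ℕ) → Status → Status
relabel f (marked m) = marked m
relabel f (paired Y) = paired (f Y)

-- When move 1 deletes A, whose bracket is trivial, a letter paired with A has a trivial bracket too.
unpair : ℕ → Status → Status
unpair A (paired Y) with Y ≟ A
... | yes _ = marked off
... | no _  = paired Y
unpair A s = s

unpair-other : ∀ {A Y} → Y ≢ A → unpair A (paired Y) ≡ paired Y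
unpair-other {A} {Y} Y≢A with Y ≟ A
... | yes Y≡A = ⊥-elim (Y≢A Y≡A)
... | no _    = refl

-- When move 2 deletes the twins A and B, a letter paired with A inherits the status of B and vice versa.
splice : ℕ → ℕ → (ℕ → Status) → Status → Status
splice A B st (paired Y) with Y ≟ A
... | yes _ = st B
... | no _ with Y ≟ B
...   | yes _ = st A
...   | no _  = paired Y
splice A B st s = s

splice-left : ∀ A B st → splice A B st (paired A) ≡ st B
splice-left A B st with A ≟ A
... | yes _ = refl
... | no A≢A = ⊥-elim (A≢A refl)

splice-right : ∀ {A B} st → A ≢ B → splice A B st (paired B) ≡ st A
splice-right {A} {B} st A≢B with B ≟ A
... | yes B≡A = ⊥-elim (A≢B (sym B≡A))
... | no _ with B ≟ B
...   | yes _ = refl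
...   | no B≢B = ⊥-elim (B≢B refl)

splice-other : ∀ {A B Y} st → Y ≢ A → Y ≢ B → splice A B st (paired Y) ≡ paired Y
splice-other {A} {B} {Y} st Y≢A Y≢B with Y ≟ A
... | yes Y≡A = ⊥-elim (Y≢A Y≡A)
... | no _ with Y ≟ B
...   | yes Y≡B = ⊥-elim (Y≢B Y≡B)
...   | no _    = refl

module _ {α : Set} (τ : α → α) where

  -- The group π and the brackets

  πCongruence : ListCongruence (α × Sign τ)
  πCongruence = record
    { _∼_ = _≈π_ τ ; ∼-refl = ≈π-refl ; ∼-sym = ≈π-sym ; ∼-trans = ≈π-trans
    ; ↭⇒∼ = ≈π-perm ; ∼-inside = ≈π-cong }

  private module Π = ListCongruenceProperties πCongruence

  infix 4 _≈ₚ_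
  _≈ₚ_ : GWord τ → GWord τ → Set
  _≈ₚ_ = _≈π_ τ

  inverse-pair : ∀ a → (a , neg) ∷ (a , pos) ∷ [] ≈ₚ []
  inverse-pair a = ≈π-trans (≈π-perm (swap _ _ ↭-refl)) (≈π-inv a)

  τ-inverse-pair : ∀ a → (a , neg) ∷ (τ a , neg) ∷ [] ≈ₚ []
  τ-inverse-pair a =
    ≈π-trans (≈π-sym (≈π-trans (≈π-cong g [] (≈π-rel a)) (Π.≡⇒∼ (++-identityʳ g))))
    (≈π-trans (≈π-perm regroup) (Π.++-cong (≈π-inv a) (≈π-inv (τ a))))
    where
    g = (a , neg) ∷ (τ a , neg) ∷ []
    regroup : g ++ (a , pos) ∷ (τ a , pos) ∷ [] ↭ (a , pos) ∷ (a , neg) ∷ (τ a , pos) ∷ (τ a , neg) ∷ []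
    regroup = ↭-trans (prep _ (swap _ _ ↭-refl)) (↭-trans (swap _ _ ↭-refl) (prep _ (prep _ (swap _ _ ↭-refl))))

  powπ-τ-cancel : ∀ a k → powπ τ a k ++ powπ τ (τ a) k ≈ₚ []
  powπ-τ-cancel a (+ 0)           = ≈π-refl
  powπ-τ-cancel a (+ 1)           = ≈π-rel a
  powπ-τ-cancel a (+ suc (suc n)) = ≈π-refl
  powπ-τ-cancel a -[1+ 0 ]        = τ-inverse-pair a
  powπ-τ-cancel a -[1+ suc n ]    = ≈π-refl

  nw≡crossing : ∀ w A B → nw τ w A B ≡ crossing (restrict τ w A B) A B
  nw≡crossing w A B with ≡-dec _≟_ (restrict τ w A B) (A ∷ B ∷ A ∷ B ∷ [])
  ... | yes _ = refl
  ... | no _ with ≡-dec _≟_ (restrict τ w A B) (B ∷ A ∷ B ∷ A ∷ [])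
  ...   | yes _ = refl
  ...   | no _  = refl

  restrict-∷-hit : ∀ {X Z P} l → OneOf X Z P → restrict τ (P ∷ l) X Z ≡ P ∷ restrict τ l X Z
  restrict-∷-hit {X} {Z} l = filter-accept (oneOf? X Z)

  restrict-∷-miss : ∀ {X Z P} l → P ≢ X → P ≢ Z → restrict τ (P ∷ l) X Z ≡ restrict τ l X Z
  restrict-∷-miss {X} {Z} l P≢X P≢Z = filter-reject (oneOf? X Z) [ P≢X , P≢Z ]′

  restrict-++ : ∀ {X Z} l m → restrict τ (l ++ m) X Z ≡ restrict τ l X Z ++ restrict τ m X Z
  restrict-++ {X} {Z} = filter-++ (oneOf? X Z)

  restrict-none : ∀ {X Z} l → X ∉ l → Z ∉ l → restrict τ l X Z ≡ []
  restrict-none {X} {Z} l X∉ Z∉ = filter-none (oneOf? X Z) (misses l X∉ Z∉)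
    where
    misses : ∀ l → X ∉ l → Z ∉ l → All (λ y → ¬ OneOf X Z y) l
    misses []      _   _   = []
    misses (y ∷ l) X∉ Z∉ = [ (λ { refl → X∉ (here refl) }) , (λ { refl → Z∉ (here refl) }) ]′
                           ∷ misses l (λ m → X∉ (there m)) (λ m → Z∉ (there m))

  restrict-ext : ∀ {X Z X′ Z′} l → (∀ y → y ∈ l → OneOf X Z y → OneOf X′ Z′ y) →
                 (∀ y → y ∈ l → OneOf X′ Z′ y → OneOf X Z y) → restrict τ l X Z ≡ restrict τ l X′ Z′
  restrict-ext [] _ _ = refl
  restrict-ext {X} {Z} {X′} {Z′} (y ∷ l) to from with oneOf? X Z y | oneOf? X′ Z′ y
  ... | yes p | yes q = trans (filter-accept (oneOf? X Z) p)
                          (trans (cong (y ∷_) (restrict-ext l (λ w m → to w (there m)) (λ w m → from w (there m))))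
                                 (sym (filter-accept (oneOf? X′ Z′) q)))
  ... | yes p | no ¬q = ⊥-elim (¬q (to y (here refl) p))
  ... | no ¬p | yes q = ⊥-elim (¬p (from y (here refl) q))
  ... | no ¬p | no ¬q = trans (filter-reject (oneOf? X Z) ¬p)
                          (trans (restrict-ext l (λ w m → to w (there m)) (λ w m → from w (there m)))
                                 (sym (filter-reject (oneOf? X′ Z′) ¬q)))

  restrict-sym : ∀ l X Z → restrict τ l X Z ≡ restrict τ l Z X
  restrict-sym l X Z = restrict-ext l (λ _ _ → [ inj₂ , inj₁ ]′) (λ _ _ → [ inj₂ , inj₁ ]′)

  restrict-swap : ∀ P Q X Z → ¬ (OneOf X Z P × OneOf X Z Q) →
                  restrict τ (P ∷ Q ∷ []) X Z ≡ restrict τ (Q ∷ P ∷ []) X Z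
  restrict-swap P Q X Z ¬both with oneOf? X Z P | oneOf? X Z Q
  ... | yes p | yes q = ⊥-elim (¬both (p , q))
  ... | yes p | no ¬q = trans (filter-accept (oneOf? X Z) p) (trans (cong (P ∷_) (filter-reject (oneOf? X Z) ¬q))
                          (sym (trans (filter-reject (oneOf? X Z) ¬q) (filter-accept (oneOf? X Z) p))))
  ... | no ¬p | yes q = trans (filter-reject (oneOf? X Z) ¬p) (trans (filter-accept (oneOf? X Z) q)
                          (sym (trans (filter-accept (oneOf? X Z) q) (cong (Q ∷_) (filter-reject (oneOf? X Z) ¬p)))))
  ... | no ¬p | no ¬q = trans (filter-reject (oneOf? X Z) ¬p) (trans (filter-reject (oneOf? X Z) ¬q)
                          (sym (trans (filter-reject (oneOf? X Z) ¬q) (filter-reject (oneOf? X Z) ¬p))))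

  restrict-map : (f : ℕ → ℕ) → (∀ {m n} → f m ≡ f n → m ≡ n) → ∀ X Z l →
                 restrict τ (map f l) (f X) (f Z) ≡ map f (restrict τ l X Z)
  restrict-map f inj X Z [] = refl
  restrict-map f inj X Z (y ∷ l) with oneOf? (f X) (f Z) (f y) | oneOf? X Z y
  ... | yes p | yes q = trans (filter-accept (oneOf? (f X) (f Z)) p)
                          (trans (cong (f y ∷_) (restrict-map f inj X Z l)) (cong (map f) (sym (filter-accept (oneOf? X Z) q))))
  ... | yes p | no ¬q = ⊥-elim (¬q ([ (λ e → inj₁ (inj e)) , (λ e → inj₂ (inj e)) ]′ p))
  ... | no ¬p | yes q = ⊥-elim (¬p ([ (λ e → inj₁ (cong f e)) , (λ e → inj₂ (cong f e)) ]′ q))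
  ... | no ¬p | no ¬q = trans (filter-reject (oneOf? (f X) (f Z)) ¬p)
                          (trans (restrict-map f inj X Z l) (cong (map f) (sym (filter-reject (oneOf? X Z) ¬q))))

  count : ℕ → List ℕ → ℕ
  count A l = length (filter (A ≟_) l)

  count-++ : ∀ A l m → count A (l ++ m) ≡ count A l + count A m
  count-++ A l m = trans (cong length (filter-++ (A ≟_) l m)) (length-++ (filter (A ≟_) l))

  count-here : ∀ A l → count A (A ∷ l) ≡ suc (count A l)
  count-here A l = cong length (filter-accept (A ≟_) {x = A} refl)

  count≡0⇒∉ : ∀ A l → count A l ≡ 0 → A ∉ l
  count≡0⇒∉ A l c≡0 A∈l = n≮n 0 (subst (0 <_) c≡0 (filter-some (A ≟_) A∈l))

  private
    sum≡2 : ∀ a b c → a + suc (b + suc c) ≡ 2 → a ≡ 0 × b ≡ 0 × c ≡ 0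
    sum≡2 zero    zero    zero    _ = refl , refl , refl
    sum≡2 zero    zero    (suc c) ()
    sum≡2 zero    (suc b) c e with trans (sym (+-suc b c)) (suc-injective (suc-injective e))
    ... | ()
    sum≡2 (suc a) b c e with trans (sym (+-suc a (b + suc c))) (suc-injective e)
    sum≡2 (suc zero)    b c e | e′ with trans (sym (+-suc b c)) (suc-injective e′)
    ... | ()
    sum≡2 (suc (suc a)) b c e | e′ with suc-injective e′
    ... | ()

  occurs-only-twice : ∀ (w : Nanoword α) A p q r → word w ≡ p ++ A ∷ q ++ A ∷ r → A ∉ p × A ∉ q × A ∉ r
  occurs-only-twice w A p q r w≡ with sum≡2 (count A p) (count A q) (count A r) counts
    where
    counts : count A p + suc (count A q + suc (count A r)) ≡ 2
    counts = begin
      count A p + suc (count A q + suc (count A r))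
        ≡⟨ cong (λ k → count A p + suc (count A q + k)) (sym (count-here A r)) ⟩
      count A p + suc (count A q + count A (A ∷ r))
        ≡⟨ cong (λ k → count A p + suc k) (sym (count-++ A q (A ∷ r))) ⟩
      count A p + suc (count A (q ++ A ∷ r))
        ≡⟨ cong (λ k → count A p + k) (sym (count-here A (q ++ A ∷ r))) ⟩
      count A p + count A (A ∷ q ++ A ∷ r)
        ≡⟨ sym (count-++ A p (A ∷ q ++ A ∷ r)) ⟩
      count A (p ++ A ∷ q ++ A ∷ r)
        ≡⟨ cong (count A) (sym w≡) ⟩
      count A (word w)
        ≡⟨ twice w A (subst (A ∈_) (sym w≡) (∈-++⁺ʳ p (here refl))) ⟩
      2 ∎
      where open ≡-Reasoning
  ... | p≡0 , q≡0 , r≡0 = count≡0⇒∉ A p p≡0 , count≡0⇒∉ A q q≡0 , count≡0⇒∉ A r r≡0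

  alphabet-unique : ∀ w → Unique (alphabet τ w)
  alphabet-unique w = deduplicate-! (word w)

  ∈-alphabet⁺ : ∀ {w X} → X ∈ word w → X ∈ alphabet τ w
  ∈-alphabet⁺ = ∈-deduplicate⁺ _≟_

  ∈-alphabet⁻ : ∀ {w X} → X ∈ alphabet τ w → X ∈ word w
  ∈-alphabet⁻ {w} = ∈-deduplicate⁻ _≟_ (word w)

  factor : Nanoword α → ℕ → ℕ → GWord τ
  factor w X Z = powπ τ (lab w Z) (nw τ (word w) X Z)

  factor-trivial : ∀ w X Z → nw τ (word w) X Z ≡ + 0 → factor w X Z ≡ []
  factor-trivial w X Z n≡0 rewrite n≡0 = refl

  factor-≡ : ∀ u v X Z → lab u Z ≡ lab v Z → restrict τ (word u) X Z ≡ restrict τ (word v) X Z →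
             factor u X Z ≡ factor v X Z
  factor-≡ u v X Z l≡ r≡ =
    cong₂ (powπ τ) l≡ (trans (nw≡crossing (word u) X Z)
                        (trans (cong (λ r → crossing r X Z) r≡) (sym (nw≡crossing (word v) X Z))))

  nw-from-restrict : ∀ (w : Nanoword α) X Z {r : List ℕ} {k : ℤ} →
                     restrict τ (word w) X Z ≡ r → crossing r X Z ≡ k → nw τ (word w) X Z ≡ k
  nw-from-restrict w X Z r≡ c≡ = trans (nw≡crossing (word w) X Z) (trans (cong (λ r → crossing r X Z) r≡) c≡)

  bracket-cong :
    ∀ u v X X′ →
    (∀ Z → Z ∈ word u → Z ∈ word v → factor u X Z ≈ₚ factor v X′ Z) →
    (∀ Z → Z ∈ word u → Z ∉ word v → factor u X Z ≈ₚ []) →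
    (∀ Z → Z ∈ word v → Z ∉ word u → factor v X′ Z ≈ₚ []) →
    bracketL τ u X ≈ₚ bracketL τ v X′
  bracket-cong u v X X′ both only-u only-v =
    Π.concatMap-cong-overlap (factor u X) (factor v X′) (alphabet τ u) (alphabet τ v)
      (alphabet-unique u) (alphabet-unique v)
      (λ Z Z∈u Z∈v → both Z (∈-alphabet⁻ {u} Z∈u) (∈-alphabet⁻ {v} Z∈v))
      (λ Z Z∈u Z∉v → only-u Z (∈-alphabet⁻ {u} Z∈u) (λ Z∈ → Z∉v (∈-alphabet⁺ {v} Z∈)))
      (λ Z Z∈v Z∉u → only-v Z (∈-alphabet⁻ {v} Z∈v) (λ Z∈ → Z∉u (∈-alphabet⁺ {u} Z∈)))

  bracket-cong-deleting :
    ∀ u v X E → Unique E → (∀ Z → Z ∈ E → Z ∈ word u) → (∀ Z → Z ∈ E → Z ∉ word v) →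
    (∀ Z → Z ∈ word v → Z ∈ word u) → (∀ Z → Z ∈ word u → Z ∉ word v → Z ∈ E) →
    concatMap (factor u X) E ≈ₚ [] →
    (∀ Z → Z ∈ word u → Z ∈ word v → factor u X Z ≈ₚ factor v X Z) →
    bracketL τ u X ≈ₚ bracketL τ v X
  bracket-cong-deleting u v X E uE E⊆u E∩v v⊆u u∖v⊆E onE both =
    Π.concatMap-cong-except (factor u X) (factor v X) (alphabet τ u) (alphabet τ v) E []
      (alphabet-unique u) (alphabet-unique v) uE []
      (λ Z Z∈ → ∈-alphabet⁺ {u} (E⊆u Z Z∈)) (λ _ ()) onE
      (λ Z _ Z∈v → let Z∈v = ∈-alphabet⁻ {v} Z∈v in
         subst₂ _≈ₚ_ (sym (Π.outside-∉ E (factor u X) (λ Z∈E → E∩v Z Z∈E Z∈v)))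
                     (sym (Π.outside-∉ [] (factor v X) (λ ())))
                     (both Z (v⊆u Z Z∈v) Z∈v))
      (λ Z Z∈u Z∉v → Π.≡⇒∼ (Π.outside-∈ E (factor u X)
         (u∖v⊆E Z (∈-alphabet⁻ {u} Z∈u) (λ Z∈ → Z∉v (∈-alphabet⁺ {v} Z∈)))))
      (λ Z Z∈v Z∉u → ⊥-elim (Z∉u (∈-alphabet⁺ {u} (v⊆u Z (∈-alphabet⁻ {v} Z∈v)))))

  bracket-cong-except :
    ∀ u v X E → Unique E → (∀ Z → Z ∈ E → Z ∈ word u) →
    (∀ Z → Z ∈ word u → Z ∈ word v) → (∀ Z → Z ∈ word v → Z ∈ word u) →
    concatMap (factor u X) E ≈ₚ concatMap (factor v X) E →
    (∀ Z → Z ∈ word u → Z ∉ E → factor u X Z ≈ₚ factor v X Z) →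
    bracketL τ u X ≈ₚ bracketL τ v X
  bracket-cong-except u v X E uE E⊆u u⊆v v⊆u onE elsewhere =
    Π.concatMap-cong-except (factor u X) (factor v X) (alphabet τ u) (alphabet τ v) E E
      (alphabet-unique u) (alphabet-unique v) uE uE
      (λ Z Z∈ → ∈-alphabet⁺ {u} (E⊆u Z Z∈)) (λ Z Z∈ → ∈-alphabet⁺ {v} (u⊆v Z (E⊆u Z Z∈))) onE both
      (λ Z Z∈u Z∉v → ⊥-elim (Z∉v (∈-alphabet⁺ {v} (u⊆v Z (∈-alphabet⁻ {u} Z∈u)))))
      (λ Z Z∈v Z∉u → ⊥-elim (Z∉u (∈-alphabet⁺ {u} (v⊆u Z (∈-alphabet⁻ {v} Z∈v)))))
    where
    both : ∀ Z → Z ∈ alphabet τ u → Z ∈ alphabet τ v → Π.outside E (factor u X) Z ≈ₚ Π.outside E (factor v X) Z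
    both Z Z∈u _ with Z ∈? E
    ... | yes _    = ≈π-refl
    ... | no Z∉E = elsewhere Z (∈-alphabet⁻ {u} Z∈u) Z∉E

  private
    adjacent-repeat : ∀ (p q : List ℕ) {A X Y : ℕ} → p ++ A ∷ A ∷ q ≡ X ∷ Y ∷ X ∷ Y ∷ [] → X ≡ Y
    adjacent-repeat []                    q refl = refl
    adjacent-repeat (_ ∷ [])              q refl = refl
    adjacent-repeat (_ ∷ _ ∷ [])          q refl = refl
    adjacent-repeat (_ ∷ _ ∷ _ ∷ [])      q ()
    adjacent-repeat (_ ∷ _ ∷ _ ∷ _ ∷ [])  q ()
    adjacent-repeat (_ ∷ _ ∷ _ ∷ _ ∷ _ ∷ p) q ()

  -- Brackets under the moves and isomorphisms

  module Move1Brackets (u v : Nanoword α) (x y : List ℕ) (A : ℕ)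
    (u≡ : word u ≡ x ++ A ∷ A ∷ y) (v≡ : word v ≡ x ++ y) (labs : ∀ n → lab u n ≡ lab v n) where

    private
      A∉x : A ∉ x
      A∉x = proj₁ (occurs-only-twice u A x [] y u≡)
      A∉y : A ∉ y
      A∉y = proj₂ (proj₂ (occurs-only-twice u A x [] y u≡))

    A∉v : A ∉ word v
    A∉v A∈v with ∈-++⁻ x (subst (A ∈_) v≡ A∈v)
    ... | inj₁ A∈x = A∉x A∈x
    ... | inj₂ A∈y = A∉y A∈y

    v⊆u : ∀ X → X ∈ word v → X ∈ word u
    v⊆u X X∈v with ∈-++⁻ x (subst (X ∈_) v≡ X∈v)
    ... | inj₁ X∈x = subst (X ∈_) (sym u≡) (∈-++⁺ˡ X∈x)
    ... | inj₂ X∈y = subst (X ∈_) (sym u≡) (∈-++⁺ʳ x (there (there X∈y)))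

    u⊆v : ∀ X → X ∈ word u → X ≢ A → X ∈ word v
    u⊆v X X∈u X≢A with ∈-++⁻ x (subst (X ∈_) u≡ X∈u)
    ... | inj₁ X∈x                 = subst (X ∈_) (sym v≡) (∈-++⁺ˡ X∈x)
    ... | inj₂ (here X≡A)          = ⊥-elim (X≢A X≡A)
    ... | inj₂ (there (here X≡A))  = ⊥-elim (X≢A X≡A)
    ... | inj₂ (there (there X∈y)) = subst (X ∈_) (sym v≡) (∈-++⁺ʳ x X∈y)

    deleted≡A : ∀ X → X ∈ word u → X ∉ word v → X ≡ A
    deleted≡A X X∈u X∉v with X ≟ A
    ... | yes X≡A = X≡A
    ... | no X≢A = ⊥-elim (X∉v (u⊆v X X∈u X≢A))

    private
      restrict-u : ∀ X Z → OneOf X Z A → restrict τ (word u) X Z ≡ restrict τ x X Z ++ A ∷ A ∷ restrict τ y X Z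
      restrict-u X Z A∈ = trans (cong (λ l → restrict τ l X Z) u≡)
        (trans (restrict-++ x (A ∷ A ∷ y))
               (cong (restrict τ x X Z ++_) (trans (restrict-∷-hit (A ∷ y) A∈) (cong (A ∷_) (restrict-∷-hit y A∈)))))

      restrict-kept : ∀ X Z → X ≢ A → Z ≢ A → restrict τ (word u) X Z ≡ restrict τ (word v) X Z
      restrict-kept X Z X≢A Z≢A = trans (cong (λ l → restrict τ l X Z) u≡)
        (trans (restrict-++ x (A ∷ A ∷ y))
        (trans (cong (restrict τ x X Z ++_)
                  (trans (restrict-∷-miss (A ∷ y) (≢-sym X≢A) (≢-sym Z≢A)) (restrict-∷-miss y (≢-sym X≢A) (≢-sym Z≢A))))
        (trans (sym (restrict-++ x y)) (cong (λ l → restrict τ l X Z) (sym v≡)))))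

      nw-A-left : ∀ Z → nw τ (word u) A Z ≡ + 0
      nw-A-left Z with Z ≟ A
      ... | yes refl = nw-from-restrict u A A
                         (trans (restrict-u A A (inj₁ refl))
                                (cong₂ (λ p q → p ++ A ∷ A ∷ q) (restrict-none x A∉x A∉x) (restrict-none y A∉y A∉y)))
                         (crossing-zero {A ∷ A ∷ []} (λ ()) (λ ()))
      ... | no Z≢A = nw-from-restrict u A Z (restrict-u A Z (inj₁ refl))
                       (crossing-zero (λ e → Z≢A (sym (adjacent-repeat (restrict τ x A Z) (restrict τ y A Z) e)))
                                   (λ e → Z≢A (adjacent-repeat (restrict τ x A Z) (restrict τ y A Z) e)))

      nw-A-right : ∀ X → X ≢ A → nw τ (word u) X A ≡ + 0
      nw-A-right X X≢A = nw-from-restrict u X A (restrict-u X A (inj₂ refl))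
        (crossing-zero (λ e → X≢A (adjacent-repeat (restrict τ x X A) (restrict τ y X A) e))
                    (λ e → X≢A (sym (adjacent-repeat (restrict τ x X A) (restrict τ y X A) e))))

    A-trivial : bracketL τ u A ≈ₚ 1π τ
    A-trivial = Π.concatMap-∼[] (factor u A) (alphabet τ u)
                  (λ Z _ → Π.≡⇒∼ (factor-trivial u A Z (nw-A-left Z)))

    bracket-kept : ∀ X → X ≢ A → bracketL τ u X ≈ₚ bracketL τ v X
    bracket-kept X X≢A = bracket-cong u v X X
      (λ Z _ Z∈v → Π.≡⇒∼ (factor-≡ u v X Z (labs Z) (restrict-kept X Z X≢A (λ { refl → A∉v Z∈v }))))
      (λ Z Z∈u Z∉v → Π.≡⇒∼ (factor-trivial u X Z
         (subst (λ Z → nw τ (word u) X Z ≡ + 0) (sym (deleted≡A Z Z∈u Z∉v)) (nw-A-right X X≢A))))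
      (λ Z Z∈v Z∉u → ⊥-elim (Z∉u (v⊆u Z Z∈v)))

  nw-map : (f : ℕ → ℕ) → (∀ {m n} → f m ≡ f n → m ≡ n) → ∀ l X Z → nw τ (map f l) (f X) (f Z) ≡ nw τ l X Z
  nw-map f inj l X Z = begin
    nw τ (map f l) (f X) (f Z)                       ≡⟨ nw≡crossing (map f l) (f X) (f Z) ⟩
    crossing (restrict τ (map f l) (f X) (f Z)) (f X) (f Z) ≡⟨ cong (λ r → crossing r (f X) (f Z)) (restrict-map f inj X Z l) ⟩
    crossing (map f (restrict τ l X Z)) (f X) (f Z)  ≡⟨ crossing-map f inj (restrict τ l X Z) X Z ⟩
    crossing (restrict τ l X Z) X Z                  ≡⟨ sym (nw≡crossing l X Z) ⟩
    nw τ l X Z                                       ∎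
    where open ≡-Reasoning

  restrict-split₂ : ∀ {X Z} x P Q y R S z →
    restrict τ (x ++ P ∷ Q ∷ y ++ R ∷ S ∷ z) X Z ≡
    restrict τ x X Z ++ restrict τ (P ∷ Q ∷ []) X Z ++ restrict τ y X Z ++ restrict τ (R ∷ S ∷ []) X Z ++ restrict τ z X Z
  restrict-split₂ x P Q y R S z =
    trans (restrict-++ x _) (cong (restrict τ x _ _ ++_)
    (trans (restrict-++ (P ∷ Q ∷ []) _) (cong (restrict τ (P ∷ Q ∷ []) _ _ ++_)
    (trans (restrict-++ y _) (cong (restrict τ y _ _ ++_) (restrict-++ (R ∷ S ∷ []) z))))))

  private
    cong-even : ∀ (p q r : List ℕ) {s s′ t t′} → s ≡ s′ → t ≡ t′ → p ++ s ++ q ++ t ++ r ≡ p ++ s′ ++ q ++ t′ ++ r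
    cong-even p q r refl refl = refl

    cong-odd : ∀ {p p′ q q′ r r′ : List ℕ} s t → p ≡ p′ → q ≡ q′ → r ≡ r′ → p ++ s ++ q ++ t ++ r ≡ p′ ++ s ++ q′ ++ t ++ r′
    cong-odd s t refl refl refl = refl

  module Move2Brackets (u v : Nanoword α) (x y z : List ℕ) (A B : ℕ)
    (u≡ : word u ≡ x ++ A ∷ B ∷ y ++ B ∷ A ∷ z) (v≡ : word v ≡ x ++ y ++ z)
    (labs : ∀ n → lab u n ≡ lab v n) (lab-B : lab u B ≡ τ (lab u A)) where

    private
      occurrences-A = occurs-only-twice u A x (B ∷ y ++ B ∷ []) z
                        (trans u≡ (cong (λ k → x ++ A ∷ B ∷ k) (sym (++-assoc y (B ∷ []) (A ∷ z)))))
      occurrences-B = occurs-only-twice u B (x ++ A ∷ []) y (A ∷ z) (trans u≡ (sym (++-assoc x (A ∷ []) _)))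

    A≢B : A ≢ B
    A≢B A≡B = proj₁ (proj₂ occurrences-A) (here A≡B)

    private
      A∉x : A ∉ x
      A∉x = proj₁ occurrences-A
      A∉y : A ∉ y
      A∉y A∈y = proj₁ (proj₂ occurrences-A) (there (∈-++⁺ˡ A∈y))
      A∉z : A ∉ z
      A∉z = proj₂ (proj₂ occurrences-A)
      B∉x : B ∉ x
      B∉x B∈x = proj₁ occurrences-B (∈-++⁺ˡ B∈x)
      B∉y : B ∉ y
      B∉y = proj₁ (proj₂ occurrences-B)
      B∉z : B ∉ z
      B∉z B∈z = proj₂ (proj₂ occurrences-B) (there B∈z)

      ∈-v⁻ : ∀ {X} → X ∈ word v → X ∈ x ⊎ X ∈ y ⊎ X ∈ z
      ∈-v⁻ {X} X∈v with ∈-++⁻ x (subst (X ∈_) v≡ X∈v)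
      ... | inj₁ X∈x = inj₁ X∈x
      ... | inj₂ X∈yz = inj₂ (∈-++⁻ y X∈yz)

      ∉v : ∀ {X} → X ∉ x → X ∉ y → X ∉ z → X ∉ word v
      ∉v X∉x X∉y X∉z X∈v = [ X∉x , [ X∉y , X∉z ]′ ]′ (∈-v⁻ X∈v)

    A∈u : A ∈ word u
    A∈u = subst (A ∈_) (sym u≡) (∈-++⁺ʳ x (here refl))

    B∈u : B ∈ word u
    B∈u = subst (B ∈_) (sym u≡) (∈-++⁺ʳ x (there (here refl)))

    A∉v : A ∉ word v
    A∉v = ∉v A∉x A∉y A∉z

    B∉v : B ∉ word v
    B∉v = ∉v B∉x B∉y B∉z

    v⊆u : ∀ X → X ∈ word v → X ∈ word u
    v⊆u X X∈v = subst (X ∈_) (sym u≡) ([ ∈-++⁺ˡ , [ (λ X∈y → ∈-++⁺ʳ x (there (there (∈-++⁺ˡ X∈y))))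
                                                    , (λ X∈z → ∈-++⁺ʳ x (there (there (∈-++⁺ʳ y (there (there X∈z)))))) ]′ ]′
                                         (∈-v⁻ X∈v))

    u⊆v : ∀ X → X ∈ word u → X ≢ A → X ≢ B → X ∈ word v
    u⊆v X X∈u X≢A X≢B with ∈-++⁻ x (subst (X ∈_) u≡ X∈u)
    ... | inj₁ X∈x = subst (X ∈_) (sym v≡) (∈-++⁺ˡ X∈x)
    ... | inj₂ (here X≡A) = ⊥-elim (X≢A X≡A)
    ... | inj₂ (there (here X≡B)) = ⊥-elim (X≢B X≡B)
    ... | inj₂ (there (there X∈rest)) with ∈-++⁻ y X∈rest
    ...   | inj₁ X∈y = subst (X ∈_) (sym v≡) (∈-++⁺ʳ x (∈-++⁺ˡ X∈y))
    ...   | inj₂ (here X≡B) = ⊥-elim (X≢B X≡B)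
    ...   | inj₂ (there (here X≡A)) = ⊥-elim (X≢A X≡A)
    ...   | inj₂ (there (there X∈z)) = subst (X ∈_) (sym v≡) (∈-++⁺ʳ x (∈-++⁺ʳ y X∈z))

    deleted≡A⊎B : ∀ X → X ∈ word u → X ∉ word v → X ≡ A ⊎ X ≡ B
    deleted≡A⊎B X X∈u X∉v with X ≟ A | X ≟ B
    ... | yes X≡A | _       = inj₁ X≡A
    ... | no _    | yes X≡B = inj₂ X≡B
    ... | no X≢A  | no X≢B  = ⊥-elim (X∉v (u⊆v X X∈u X≢A X≢B))

    private
      restrict-u : ∀ X Z → restrict τ (word u) X Z ≡
        restrict τ x X Z ++ restrict τ (A ∷ B ∷ []) X Z ++ restrict τ y X Z ++ restrict τ (B ∷ A ∷ []) X Z ++ restrict τ z X Z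
      restrict-u X Z = trans (cong (λ l → restrict τ l X Z) u≡) (restrict-split₂ x A B y B A z)

      restrict-kept : ∀ X Z → X ≢ A → X ≢ B → Z ≢ A → Z ≢ B → restrict τ (word u) X Z ≡ restrict τ (word v) X Z
      restrict-kept X Z X≢A X≢B Z≢A Z≢B =
        trans (restrict-u X Z)
        (trans (cong-even (restrict τ x X Z) (restrict τ y X Z) (restrict τ z X Z)
                 (restrict-none (A ∷ B ∷ []) ∉AB[X] ∉AB[Z]) (restrict-none (B ∷ A ∷ []) ∉BA[X] ∉BA[Z]))
        (trans (sym (trans (restrict-++ x _) (cong (restrict τ x X Z ++_) (restrict-++ y z))))
               (cong (λ l → restrict τ l X Z) (sym v≡))))
        where
        ∉AB[X] : X ∉ A ∷ B ∷ []
        ∉AB[X] = λ { (here e) → X≢A e ; (there (here e)) → X≢B e }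
        ∉AB[Z] : Z ∉ A ∷ B ∷ []
        ∉AB[Z] = λ { (here e) → Z≢A e ; (there (here e)) → Z≢B e }
        ∉BA[X] : X ∉ B ∷ A ∷ []
        ∉BA[X] = λ { (here e) → X≢B e ; (there (here e)) → X≢A e }
        ∉BA[Z] : Z ∉ B ∷ A ∷ []
        ∉BA[Z] = λ { (here e) → Z≢B e ; (there (here e)) → Z≢A e }

      -- Renaming A ↔ B turns u into swapped, which differs from u only in the order of two adjacent
      -- pairs; this gives n(A,Z) = n(B,Z) and n(X,A) = n(X,B) for X, Z ∉ {A, B}.
      swapped : List ℕ
      swapped = x ++ B ∷ A ∷ y ++ A ∷ B ∷ z

      transposed-u : map (transpose A B) (word u) ≡ swapped
      transposed-u = begin
        map (transpose A B) (word u)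
          ≡⟨ cong (map (transpose A B)) u≡ ⟩
        map (transpose A B) (x ++ A ∷ B ∷ y ++ B ∷ A ∷ z)
          ≡⟨ map-++ (transpose A B) x _ ⟩
        map (transpose A B) x ++ transpose A B A ∷ transpose A B B ∷ map (transpose A B) (y ++ B ∷ A ∷ z)
          ≡⟨ cong₂ (λ p q → p ++ transpose A B A ∷ transpose A B B ∷ q) (map-transpose-fresh A B x A∉x B∉x)
                   (map-++ (transpose A B) y _) ⟩
        x ++ transpose A B A ∷ transpose A B B ∷ map (transpose A B) y ++ transpose A B B ∷ transpose A B A ∷ map (transpose A B) z
          ≡⟨ cong₂ (λ p q → x ++ transpose A B A ∷ transpose A B B ∷ p ++ transpose A B B ∷ transpose A B A ∷ q)
                   (map-transpose-fresh A B y A∉y B∉y) (map-transpose-fresh A B z A∉z B∉z) ⟩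
        x ++ transpose A B A ∷ transpose A B B ∷ y ++ transpose A B B ∷ transpose A B A ∷ z
          ≡⟨ cong₂ (λ p q → x ++ p ∷ q ∷ y ++ q ∷ p ∷ z) (transpose-left A B) (transpose-right A B) ⟩
        swapped ∎
        where open ≡-Reasoning

      nw-swapped : ∀ X Z → ¬ (OneOf X Z A × OneOf X Z B) → nw τ swapped X Z ≡ nw τ (word u) X Z
      nw-swapped X Z ¬AB = begin
        nw τ swapped X Z ≡⟨ nw≡crossing swapped X Z ⟩
        crossing (restrict τ swapped X Z) X Z ≡⟨ cong (λ r → crossing r X Z) restricts ⟩
        crossing (restrict τ (word u) X Z) X Z ≡⟨ sym (nw≡crossing (word u) X Z) ⟩
        nw τ (word u) X Z ∎
        where
        open ≡-Reasoning
        restricts : restrict τ swapped X Z ≡ restrict τ (word u) X Z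
        restricts = trans (restrict-split₂ x B A y A B z)
          (trans (cong-even (restrict τ x X Z) (restrict τ y X Z) (restrict τ z X Z)
                   (restrict-swap B A X Z (λ { (b , a) → ¬AB (a , b) })) (restrict-swap A B X Z ¬AB))
                 (sym (restrict-u X Z)))

      nw-transposed : ∀ X Z → nw τ (word u) X Z ≡ nw τ swapped (transpose A B X) (transpose A B Z)
      nw-transposed X Z = trans (sym (nw-map (transpose A B) (transpose-injective A B) (word u) X Z))
                                (cong (λ l → nw τ l (transpose A B X) (transpose A B Z)) transposed-u)

      nw-A≡nw-B-left : ∀ Z → Z ≢ A → Z ≢ B → nw τ (word u) A Z ≡ nw τ (word u) B Z
      nw-A≡nw-B-left Z Z≢A Z≢B =
        trans (nw-transposed A Z)
        (trans (cong₂ (nw τ swapped) (transpose-left A B) (transpose-other A B Z Z≢A Z≢B))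
               (nw-swapped B Z λ { (inj₁ A≡B , _) → A≢B A≡B ; (inj₂ A≡Z , _) → Z≢A (sym A≡Z) }))

      nw-A≡nw-B-right : ∀ X → X ≢ A → X ≢ B → nw τ (word u) X A ≡ nw τ (word u) X B
      nw-A≡nw-B-right X X≢A X≢B =
        trans (nw-transposed X A)
        (trans (cong₂ (nw τ swapped) (transpose-other A B X X≢A X≢B) (transpose-left A B))
               (nw-swapped X B λ { (inj₁ A≡X , _) → X≢A (sym A≡X) ; (inj₂ A≡B , _) → A≢B A≡B }))

      restrict-on-AB : ∀ P Q → OneOf A B P → OneOf A B Q →
                       restrict τ (word u) P Q ≡ restrict τ (A ∷ B ∷ []) P Q ++ restrict τ (B ∷ A ∷ []) P Q ++ []
      restrict-on-AB P Q P∈ Q∈ =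
        trans (restrict-u P Q) (cong-odd (restrict τ (A ∷ B ∷ []) P Q) (restrict τ (B ∷ A ∷ []) P Q)
                                         (restrict-none x (∉ P∈ A∉x B∉x) (∉ Q∈ A∉x B∉x))
                                         (restrict-none y (∉ P∈ A∉y B∉y) (∉ Q∈ A∉y B∉y))
                                         (restrict-none z (∉ P∈ A∉z B∉z) (∉ Q∈ A∉z B∉z)))
        where
        ∉ : ∀ {P l} → OneOf A B P → A ∉ l → B ∉ l → P ∉ l
        ∉ (inj₁ refl) A∉ _ = A∉
        ∉ (inj₂ refl) _ B∉ = B∉

      B≢A : B ≢ A
      B≢A = ≢-sym A≢B

      nw-AA : nw τ (word u) A A ≡ + 0
      nw-AA = nw-from-restrict u A A
        (trans (restrict-on-AB A A (inj₁ refl) (inj₁ refl))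
               (cong₂ (λ p q → p ++ q ++ [])
                      (trans (restrict-∷-hit (B ∷ []) (inj₁ refl)) (cong (A ∷_) (restrict-∷-miss [] B≢A B≢A)))
                      (trans (restrict-∷-miss (A ∷ []) B≢A B≢A) (restrict-∷-hit [] (inj₁ refl)))))
        (crossing-zero {A ∷ A ∷ []} (λ ()) (λ ()))

      nw-BB : nw τ (word u) B B ≡ + 0
      nw-BB = nw-from-restrict u B B
        (trans (restrict-on-AB B B (inj₂ refl) (inj₂ refl))
               (cong₂ (λ p q → p ++ q ++ [])
                      (trans (restrict-∷-miss {B} {B} (B ∷ []) A≢B A≢B) (restrict-∷-hit {B} {B} [] (inj₁ refl)))
                      (trans (restrict-∷-hit {B} {B} (A ∷ []) (inj₁ refl)) (cong (B ∷_) (restrict-∷-miss {B} {B} [] A≢B A≢B)))))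
        (crossing-zero {B ∷ B ∷ []} (λ ()) (λ ()))

      restrict-AB : restrict τ (word u) A B ≡ A ∷ B ∷ B ∷ A ∷ []
      restrict-AB =
        trans (restrict-on-AB A B (inj₁ refl) (inj₂ refl))
              (cong₂ (λ p q → p ++ q ++ [])
                     (trans (restrict-∷-hit (B ∷ []) (inj₁ refl)) (cong (A ∷_) (restrict-∷-hit [] (inj₂ refl))))
                     (trans (restrict-∷-hit (A ∷ []) (inj₂ refl)) (cong (B ∷_) (restrict-∷-hit [] (inj₁ refl)))))

      nw-AB : nw τ (word u) A B ≡ + 0
      nw-AB = nw-from-restrict u A B restrict-AB
                (crossing-zero (λ e → B≢A (third-≡ e))
                            (λ e → A≢B (head-≡ e)))

      nw-BA : nw τ (word u) B A ≡ + 0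
      nw-BA = nw-from-restrict u B A (trans (restrict-sym (word u) B A) restrict-AB)
                (crossing-zero (λ e → A≢B (head-≡ e))
                            (λ e → B≢A (third-≡ e)))

      nw-A≡nw-B : ∀ Z → nw τ (word u) A Z ≡ nw τ (word u) B Z
      nw-A≡nw-B Z with Z ≟ A | Z ≟ B
      ... | yes refl | _        = trans nw-AA (sym nw-BA)
      ... | no _     | yes refl = trans nw-AB (sym nw-BB)
      ... | no Z≢A   | no Z≢B   = nw-A≡nw-B-left Z Z≢A Z≢B

    twins-bracket : bracketL τ u A ≈ₚ bracketL τ u B
    twins-bracket = Π.concatMap-cong (factor u A) (factor u B) (alphabet τ u)
                      (λ Z _ → Π.≡⇒∼ (cong (powπ τ (lab u Z)) (nw-A≡nw-B Z)))

    bracket-kept : ∀ X → X ≢ A → X ≢ B → bracketL τ u X ≈ₚ bracketL τ v X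
    bracket-kept X X≢A X≢B =
      bracket-cong-deleting u v X (A ∷ B ∷ []) ((A≢B ∷ []) ∷ [] ∷ [])
        (λ { _ (here refl) → A∈u ; _ (there (here refl)) → B∈u })
        (λ { _ (here refl) → A∉v ; _ (there (here refl)) → B∉v })
        v⊆u
        (λ Z Z∈u Z∉v → [ (λ { refl → here refl }) , (λ { refl → there (here refl) }) ]′ (deleted≡A⊎B Z Z∈u Z∉v))
        cancel
        (λ Z _ Z∈v → Π.≡⇒∼ (factor-≡ u v X Z (labs Z)
          (restrict-kept X Z X≢A X≢B (λ { refl → A∉v Z∈v }) (λ { refl → B∉v Z∈v }))))
      where
      cancel : factor u X A ++ factor u X B ++ [] ≈ₚ []
      cancel rewrite ++-identityʳ (factor u X B) | sym (nw-A≡nw-B-right X X≢A X≢B) | lab-B =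
        powπ-τ-cancel (lab u A) (nw τ (word u) X A)

  restrict-split₃ : ∀ {X Z} x P Q y R S z T U t →
    restrict τ (x ++ P ∷ Q ∷ y ++ R ∷ S ∷ z ++ T ∷ U ∷ t) X Z ≡
    restrict τ x X Z ++ restrict τ (P ∷ Q ∷ []) X Z ++ restrict τ y X Z ++ restrict τ (R ∷ S ∷ []) X Z ++
    restrict τ z X Z ++ restrict τ (T ∷ U ∷ []) X Z ++ restrict τ t X Z
  restrict-split₃ x P Q y R S z T U t =
    trans (restrict-split₂ x P Q y R S (z ++ T ∷ U ∷ t))
          (cong (λ r → restrict τ x _ _ ++ restrict τ (P ∷ Q ∷ []) _ _ ++ restrict τ y _ _ ++
                       restrict τ (R ∷ S ∷ []) _ _ ++ r)
                (trans (restrict-++ z _) (cong (restrict τ z _ _ ++_) (restrict-++ (T ∷ U ∷ []) t))))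

  private
    cong-++₇ : ∀ {a₁ a₂ a₃ a₄ a₅ a₆ a₇ b₁ b₂ b₃ b₄ b₅ b₆ b₇ : List ℕ} →
               a₁ ≡ b₁ → a₂ ≡ b₂ → a₃ ≡ b₃ → a₄ ≡ b₄ → a₅ ≡ b₅ → a₆ ≡ b₆ → a₇ ≡ b₇ →
               a₁ ++ a₂ ++ a₃ ++ a₄ ++ a₅ ++ a₆ ++ a₇ ≡ b₁ ++ b₂ ++ b₃ ++ b₄ ++ b₅ ++ b₆ ++ b₇
    cong-++₇ refl refl refl refl refl refl refl = refl

    ¬OneOf : ∀ {X Z P} → P ≢ X → P ≢ Z → ¬ OneOf X Z P
    ¬OneOf P≢X P≢Z = [ P≢X , P≢Z ]′

  module Move3Brackets (u v : Nanoword α) (x y z t : List ℕ) (A B C : ℕ)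
    (A≢B : A ≢ B) (B≢C : B ≢ C) (A≢C : A ≢ C) (lab-AB : lab u A ≡ lab u B) (lab-BC : lab u B ≡ lab u C)
    (u≡ : word u ≡ x ++ A ∷ B ∷ y ++ A ∷ C ∷ z ++ B ∷ C ∷ t)
    (v≡ : word v ≡ x ++ B ∷ A ∷ y ++ C ∷ A ∷ z ++ C ∷ B ∷ t)
    (labs : ∀ n → lab u n ≡ lab v n) where

    private
      B≢A = ≢-sym A≢B
      C≢B = ≢-sym B≢C
      C≢A = ≢-sym A≢C

      v↭u : word v ↭ word u
      v↭u = ↭-trans (↭-reflexive v≡)
            (↭-trans (++⁺ˡ x (swap B A (++⁺ˡ y (swap C A (++⁺ˡ z (swap C B ↭-refl))))))
                     (↭-reflexive (sym u≡)))

    u⊆v : ∀ X → X ∈ word u → X ∈ word v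
    u⊆v X = ∈-resp-↭ (↭-sym v↭u)

    v⊆u : ∀ X → X ∈ word v → X ∈ word u
    v⊆u X = ∈-resp-↭ v↭u

    private
      occurrences-A = occurs-only-twice u A x (B ∷ y) (C ∷ z ++ B ∷ C ∷ t) u≡
      occurrences-B = occurs-only-twice u B (x ++ A ∷ []) (y ++ A ∷ C ∷ z) (C ∷ t)
        (trans u≡ (trans (cong (λ k → x ++ A ∷ B ∷ k) (sym (++-assoc y (A ∷ C ∷ z) (B ∷ C ∷ t))))
                         (sym (++-assoc x (A ∷ []) _))))
      occurrences-C = occurs-only-twice u C (x ++ A ∷ B ∷ y ++ A ∷ []) (z ++ B ∷ []) t
        (trans u≡ (trans (cong (λ k → x ++ A ∷ B ∷ k)
                           (trans (cong (λ k → y ++ A ∷ C ∷ k) (sym (++-assoc z (B ∷ []) (C ∷ t))))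
                                  (sym (++-assoc y (A ∷ []) _))))
                         (sym (++-assoc x (A ∷ B ∷ y ++ A ∷ []) _))))

      A∉x : A ∉ x
      A∉x = proj₁ occurrences-A
      A∉y : A ∉ y
      A∉y A∈ = proj₁ (proj₂ occurrences-A) (there A∈)
      A∉z : A ∉ z
      A∉z A∈ = proj₂ (proj₂ occurrences-A) (there (∈-++⁺ˡ A∈))
      A∉t : A ∉ t
      A∉t A∈ = proj₂ (proj₂ occurrences-A) (there (∈-++⁺ʳ z (there (there A∈))))
      B∉x : B ∉ x
      B∉x B∈ = proj₁ occurrences-B (∈-++⁺ˡ B∈)
      B∉y : B ∉ y
      B∉y B∈ = proj₁ (proj₂ occurrences-B) (∈-++⁺ˡ B∈)
      B∉z : B ∉ z
      B∉z B∈ = proj₁ (proj₂ occurrences-B) (∈-++⁺ʳ y (there (there B∈)))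
      B∉t : B ∉ t
      B∉t B∈ = proj₂ (proj₂ occurrences-B) (there B∈)
      C∉x : C ∉ x
      C∉x C∈ = proj₁ occurrences-C (∈-++⁺ˡ C∈)
      C∉y : C ∉ y
      C∉y C∈ = proj₁ occurrences-C (∈-++⁺ʳ x (there (there (∈-++⁺ˡ C∈))))
      C∉z : C ∉ z
      C∉z C∈ = proj₁ (proj₂ occurrences-C) (∈-++⁺ˡ C∈)
      C∉t : C ∉ t
      C∉t = proj₂ (proj₂ occurrences-C)

      around : ℕ → ℕ → List ℕ → List ℕ → List ℕ → List ℕ
      around X Z p q r = restrict τ x X Z ++ p ++ restrict τ y X Z ++ q ++ restrict τ z X Z ++ r ++ restrict τ t X Z

      restrict-u : ∀ X Z → restrict τ (word u) X Z ≡
                   around X Z (restrict τ (A ∷ B ∷ []) X Z) (restrict τ (A ∷ C ∷ []) X Z) (restrict τ (B ∷ C ∷ []) X Z)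
      restrict-u X Z = trans (cong (λ l → restrict τ l X Z) u≡) (restrict-split₃ x A B y A C z B C t)

      restrict-v : ∀ X Z → restrict τ (word v) X Z ≡
                   around X Z (restrict τ (B ∷ A ∷ []) X Z) (restrict τ (C ∷ A ∷ []) X Z) (restrict τ (C ∷ B ∷ []) X Z)
      restrict-v X Z = trans (cong (λ l → restrict τ l X Z) v≡) (restrict-split₃ x B A y C A z C B t)

      restrict-unchanged : ∀ X Z → ¬ (OneOf X Z A × OneOf X Z B) → ¬ (OneOf X Z A × OneOf X Z C) →
                           ¬ (OneOf X Z B × OneOf X Z C) → restrict τ (word u) X Z ≡ restrict τ (word v) X Z
      restrict-unchanged X Z ¬AB ¬AC ¬BC =
        trans (restrict-u X Z)
        (trans (cong₃ (around X Z) (restrict-swap A B X Z ¬AB) (restrict-swap A C X Z ¬AC) (restrict-swap B C X Z ¬BC))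
               (sym (restrict-v X Z)))
        where
        cong₃ : ∀ (f : List ℕ → List ℕ → List ℕ → List ℕ) {p p′ q q′ r r′} →
                p ≡ p′ → q ≡ q′ → r ≡ r′ → f p q r ≡ f p′ q′ r′
        cong₃ f refl refl refl = refl

      hit₁ : ∀ {X Z P Q} → OneOf X Z P → Q ≢ X → Q ≢ Z → restrict τ (P ∷ Q ∷ []) X Z ≡ P ∷ []
      hit₁ P∈ Q≢X Q≢Z = trans (restrict-∷-hit _ P∈) (cong (_ ∷_) (restrict-∷-miss [] Q≢X Q≢Z))

      hit₂ : ∀ {X Z P Q} → P ≢ X → P ≢ Z → OneOf X Z Q → restrict τ (P ∷ Q ∷ []) X Z ≡ Q ∷ []
      hit₂ P≢X P≢Z Q∈ = trans (restrict-∷-miss _ P≢X P≢Z) (restrict-∷-hit [] Q∈)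

      hit₁₂ : ∀ {X Z P Q} → OneOf X Z P → OneOf X Z Q → restrict τ (P ∷ Q ∷ []) X Z ≡ P ∷ Q ∷ []
      hit₁₂ P∈ Q∈ = trans (restrict-∷-hit _ P∈) (cong (_ ∷_) (restrict-∷-hit [] Q∈))

      u-AB : restrict τ (word u) A B ≡ A ∷ B ∷ A ∷ B ∷ []
      u-AB = trans (restrict-u A B)
        (cong-++₇ (restrict-none x A∉x B∉x) (hit₁₂ (inj₁ refl) (inj₂ refl)) (restrict-none y A∉y B∉y)
                  (hit₁ (inj₁ refl) C≢A C≢B) (restrict-none z A∉z B∉z) (hit₁ (inj₂ refl) C≢A C≢B) (restrict-none t A∉t B∉t))

      u-AC : restrict τ (word u) A C ≡ A ∷ A ∷ C ∷ C ∷ []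
      u-AC = trans (restrict-u A C)
        (cong-++₇ (restrict-none x A∉x C∉x) (hit₁ (inj₁ refl) B≢A B≢C) (restrict-none y A∉y C∉y)
                  (hit₁₂ (inj₁ refl) (inj₂ refl)) (restrict-none z A∉z C∉z) (hit₂ B≢A B≢C (inj₂ refl)) (restrict-none t A∉t C∉t))

      u-BC : restrict τ (word u) B C ≡ B ∷ C ∷ B ∷ C ∷ []
      u-BC = trans (restrict-u B C)
        (cong-++₇ (restrict-none x B∉x C∉x) (hit₂ A≢B A≢C (inj₁ refl)) (restrict-none y B∉y C∉y)
                  (hit₂ A≢B A≢C (inj₂ refl)) (restrict-none z B∉z C∉z) (hit₁₂ (inj₁ refl) (inj₂ refl)) (restrict-none t B∉t C∉t))

      v-AB : restrict τ (word v) A B ≡ B ∷ A ∷ A ∷ B ∷ []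
      v-AB = trans (restrict-v A B)
        (cong-++₇ (restrict-none x A∉x B∉x) (hit₁₂ (inj₂ refl) (inj₁ refl)) (restrict-none y A∉y B∉y)
                  (hit₂ C≢A C≢B (inj₁ refl)) (restrict-none z A∉z B∉z) (hit₂ C≢A C≢B (inj₂ refl)) (restrict-none t A∉t B∉t))

      v-AC : restrict τ (word v) A C ≡ A ∷ C ∷ A ∷ C ∷ []
      v-AC = trans (restrict-v A C)
        (cong-++₇ (restrict-none x A∉x C∉x) (hit₂ B≢A B≢C (inj₁ refl)) (restrict-none y A∉y C∉y)
                  (hit₁₂ (inj₂ refl) (inj₁ refl)) (restrict-none z A∉z C∉z) (hit₁ (inj₂ refl) B≢A B≢C) (restrict-none t A∉t C∉t))

      v-BC : restrict τ (word v) B C ≡ B ∷ C ∷ C ∷ B ∷ []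
      v-BC = trans (restrict-v B C)
        (cong-++₇ (restrict-none x B∉x C∉x) (hit₁ (inj₁ refl) A≢B A≢C) (restrict-none y B∉y C∉y)
                  (hit₁ (inj₂ refl) A≢B A≢C) (restrict-none z B∉z C∉z) (hit₁₂ (inj₂ refl) (inj₁ refl)) (restrict-none t B∉t C∉t))

      nw-u-AB : nw τ (word u) A B ≡ + 1
      nw-u-AB = nw-from-restrict u A B u-AB (crossing-positive {A} {B})
      nw-u-BA : nw τ (word u) B A ≡ -[1+ 0 ]
      nw-u-BA = nw-from-restrict u B A (trans (restrict-sym (word u) B A) u-AB) (crossing-negative B≢A)
      nw-u-AC : nw τ (word u) A C ≡ + 0
      nw-u-AC = nw-from-restrict u A C u-AC
                  (crossing-zero (λ e → A≢C (second-≡ e)) (λ e → A≢C (head-≡ e)))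
      nw-u-CA : nw τ (word u) C A ≡ + 0
      nw-u-CA = nw-from-restrict u C A (trans (restrict-sym (word u) C A) u-AC)
                  (crossing-zero (λ e → A≢C (head-≡ e)) (λ e → A≢C (second-≡ e)))
      nw-u-BC : nw τ (word u) B C ≡ + 1
      nw-u-BC = nw-from-restrict u B C u-BC (crossing-positive {B} {C})
      nw-u-CB : nw τ (word u) C B ≡ -[1+ 0 ]
      nw-u-CB = nw-from-restrict u C B (trans (restrict-sym (word u) C B) u-BC) (crossing-negative C≢B)
      nw-v-AB : nw τ (word v) A B ≡ + 0
      nw-v-AB = nw-from-restrict v A B v-AB
                  (crossing-zero (λ e → B≢A (head-≡ e)) (λ e → A≢B (third-≡ e)))
      nw-v-BA : nw τ (word v) B A ≡ + 0
      nw-v-BA = nw-from-restrict v B A (trans (restrict-sym (word v) B A) v-AB)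
                  (crossing-zero (λ e → A≢B (third-≡ e)) (λ e → B≢A (head-≡ e)))
      nw-v-AC : nw τ (word v) A C ≡ + 1
      nw-v-AC = nw-from-restrict v A C v-AC (crossing-positive {A} {C})
      nw-v-CA : nw τ (word v) C A ≡ -[1+ 0 ]
      nw-v-CA = nw-from-restrict v C A (trans (restrict-sym (word v) C A) v-AC) (crossing-negative C≢A)
      nw-v-BC : nw τ (word v) B C ≡ + 0
      nw-v-BC = nw-from-restrict v B C v-BC
                  (crossing-zero (λ e → C≢B (third-≡ e)) (λ e → B≢C (head-≡ e)))
      nw-v-CB : nw τ (word v) C B ≡ + 0
      nw-v-CB = nw-from-restrict v C B (trans (restrict-sym (word v) C B) v-BC)
                  (crossing-zero (λ e → B≢C (head-≡ e)) (λ e → C≢B (third-≡ e)))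

      factor-is : ∀ (w : Nanoword α) X Z {k} → nw τ (word w) X Z ≡ k → factor w X Z ≡ powπ τ (lab w Z) k
      factor-is w X Z = cong (powπ τ (lab w Z))

      A∈u : A ∈ word u
      A∈u = subst (A ∈_) (sym u≡) (∈-++⁺ʳ x (here refl))
      B∈u : B ∈ word u
      B∈u = subst (B ∈_) (sym u≡) (∈-++⁺ʳ x (there (here refl)))
      C∈u : C ∈ word u
      C∈u = subst (C ∈_) (sym u≡) (∈-++⁺ʳ x (there (there (∈-++⁺ʳ y (there (here refl))))))

      pair-unique : ∀ {P Q : ℕ} → P ≢ Q → Unique (P ∷ Q ∷ [])
      pair-unique P≢Q = (P≢Q ∷ []) ∷ [] ∷ []

      pair-⊆ : ∀ {P Q} → P ∈ word u → Q ∈ word u → ∀ Z → Z ∈ P ∷ Q ∷ [] → Z ∈ word u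
      pair-⊆ P∈ Q∈ Z (here refl)         = P∈
      pair-⊆ P∈ Q∈ Z (there (here refl)) = Q∈

      factor-unchanged : ∀ X Z → ¬ (OneOf X Z A × OneOf X Z B) → ¬ (OneOf X Z A × OneOf X Z C) →
                         ¬ (OneOf X Z B × OneOf X Z C) → factor u X Z ≈ₚ factor v X Z
      factor-unchanged X Z ¬AB ¬AC ¬BC = Π.≡⇒∼ (factor-≡ u v X Z (labs Z) (restrict-unchanged X Z ¬AB ¬AC ¬BC))

      factor-unchanged-from : ∀ {X P Q} Z → X ≢ P → X ≢ Q → Z ∉ P ∷ Q ∷ [] → ¬ OneOf X Z P × ¬ OneOf X Z Q
      factor-unchanged-from Z X≢P X≢Q Z∉ =
        ¬OneOf (≢-sym X≢P) (λ e → Z∉ (here (sym e))) , ¬OneOf (≢-sym X≢Q) (λ e → Z∉ (there (here (sym e))))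

    bracket-same : ∀ X → bracketL τ u X ≈ₚ bracketL τ v X
    bracket-same X with X ≟ A | X ≟ B | X ≟ C
    ... | yes refl | _ | _ =
      bracket-cong-except u v A (B ∷ C ∷ []) (pair-unique B≢C) (pair-⊆ B∈u C∈u) u⊆v v⊆u
        (Π.≡⇒∼ (trans (cong₂ (λ p q → p ++ q ++ []) (factor-is u A B nw-u-AB) (factor-is u A C nw-u-AC))
               (trans (cong (λ l → (l , pos) ∷ []) (trans lab-BC (labs C)))
                      (sym (cong₂ (λ p q → p ++ q ++ []) (factor-is v A B nw-v-AB) (factor-is v A C nw-v-AC))))))
        (λ Z _ Z∉ → let ¬B , ¬C = factor-unchanged-from Z A≢B A≢C Z∉ in
                    factor-unchanged A Z (λ (_ , b) → ¬B b) (λ (_ , c) → ¬C c) (λ (b , _) → ¬B b))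
    ... | no X≢A | yes refl | _ =
      bracket-cong-except u v B (A ∷ C ∷ []) (pair-unique A≢C) (pair-⊆ A∈u C∈u) u⊆v v⊆u
        (≈π-trans (Π.≡⇒∼ (cong₂ (λ p q → p ++ q ++ []) (factor-is u B A nw-u-BA) (factor-is u B C nw-u-BC)))
        (≈π-trans (Π.≡⇒∼ (cong (λ l → (lab u A , neg) ∷ (l , pos) ∷ []) (sym (trans lab-AB lab-BC))))
        (≈π-trans (inverse-pair (lab u A))
                  (Π.≡⇒∼ (sym (cong₂ (λ p q → p ++ q ++ []) (factor-is v B A nw-v-BA) (factor-is v B C nw-v-BC)))))))
        (λ Z _ Z∉ → let ¬A , ¬C = factor-unchanged-from Z B≢A B≢C Z∉ in
                    factor-unchanged B Z (λ (a , _) → ¬A a) (λ (a , _) → ¬A a) (λ (_ , c) → ¬C c))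
    ... | no X≢A | no X≢B | yes refl =
      bracket-cong-except u v C (A ∷ B ∷ []) (pair-unique A≢B) (pair-⊆ A∈u B∈u) u⊆v v⊆u
        (Π.≡⇒∼ (trans (cong₂ (λ p q → p ++ q ++ []) (factor-is u C A nw-u-CA) (factor-is u C B nw-u-CB))
               (trans (cong (λ l → (l , neg) ∷ []) (trans (sym lab-AB) (labs A)))
                      (sym (cong₂ (λ p q → p ++ q ++ []) (factor-is v C A nw-v-CA) (factor-is v C B nw-v-CB))))))
        (λ Z _ Z∉ → let ¬A , ¬B = factor-unchanged-from Z C≢A C≢B Z∉ in
                    factor-unchanged C Z (λ (a , _) → ¬A a) (λ (a , _) → ¬A a) (λ (b , _) → ¬B b))
    ... | no X≢A | no X≢B | no X≢C =
      bracket-cong u v X X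
        (λ Z _ _ → factor-unchanged X Z (distinct A≢B X≢A X≢B) (distinct A≢C X≢A X≢C) (distinct B≢C X≢B X≢C))
        (λ Z Z∈u Z∉v → ⊥-elim (Z∉v (u⊆v Z Z∈u)))
        (λ Z Z∈v Z∉u → ⊥-elim (Z∉u (v⊆u Z Z∈v)))
      where
      distinct : ∀ {Z P Q} → P ≢ Q → X ≢ P → X ≢ Q → ¬ (OneOf X Z P × OneOf X Z Q)
      distinct P≢Q X≢P X≢Q (inj₁ P≡X , _)       = X≢P (sym P≡X)
      distinct P≢Q X≢P X≢Q (_ , inj₁ Q≡X)       = X≢Q (sym Q≡X)
      distinct P≢Q X≢P X≢Q (inj₂ P≡Z , inj₂ Q≡Z) = P≢Q (trans P≡Z (sym Q≡Z))

  record LetterBijection (u v : Nanoword α) : Set where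
    field
      to           : ℕ → ℕ
      to-injective : ∀ {m n} → to m ≡ to n → m ≡ n
      from         : ℕ → ℕ
      to∈          : ∀ {X} → X ∈ word u → to X ∈ word v
      from∈        : ∀ {Y} → Y ∈ word v → from Y ∈ word u
      to-from      : ∀ {Y} → Y ∈ word v → to (from Y) ≡ Y
      lab-to       : ∀ {X} → X ∈ word u → lab v (to X) ≡ lab u X
      bracket-to   : ∀ {X} → X ∈ word u → bracketL τ v (to X) ≈ₚ bracketL τ u X

    from-to : ∀ {X} → X ∈ word u → from (to X) ≡ X
    from-to X∈ = to-injective (to-from (to∈ X∈))

    concatMap-alphabet : ∀ {T} (C : ListCongruence T) (h : ℕ → List T) →
                         ListCongruence._∼_ C (concatMap h (alphabet τ v)) (concatMap (λ X → h (to X)) (alphabet τ u))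
    concatMap-alphabet C h =
      ListCongruenceProperties.concatMap-reindex C h to to-injective (alphabet τ u) (alphabet τ v)
        (alphabet-unique u) (alphabet-unique v)
        (λ X X∈ → ∈-alphabet⁺ {v} (to∈ (∈-alphabet⁻ {u} X∈)))
        (λ Y Y∈ → let Y∈v = ∈-alphabet⁻ {v} Y∈ in from Y , ∈-alphabet⁺ {u} (from∈ Y∈v) , sym (to-from Y∈v))

  preimage : (ℕ → ℕ) → List ℕ → ℕ → ℕ
  preimage f []      Y = Y   -- junk: Y is not in the image
  preimage f (X ∷ L) Y with f X ≟ Y
  ... | yes _ = X
  ... | no _  = preimage f L Y

  preimage-spec : ∀ f L {Y} → Y ∈ map f L → preimage f L Y ∈ L × f (preimage f L Y) ≡ Y
  preimage-spec f (X ∷ L) {Y} Y∈ with f X ≟ Y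
  preimage-spec f (X ∷ L) {Y} Y∈             | yes fX≡Y = here refl , fX≡Y
  preimage-spec f (X ∷ L) {Y} (here Y≡fX)    | no fX≢Y = ⊥-elim (fX≢Y (sym Y≡fX))
  preimage-spec f (X ∷ L) {Y} (there Y∈)     | no _    = let p∈ , fp≡ = preimage-spec f L Y∈ in there p∈ , fp≡

  iso-bijection : ∀ {u v} → Iso τ u v → LetterBijection u v
  iso-bijection {u} {v} (iso f inj map≡ labs) = record
    { to = f ; to-injective = inj ; from = from
    ; to∈ = to∈ ; from∈ = λ Y∈ → proj₁ (preimage-spec f (word u) (∈-mapped Y∈))
    ; to-from = λ Y∈ → proj₂ (preimage-spec f (word u) (∈-mapped Y∈))
    ; lab-to = λ {X} → labs X ; bracket-to = bracket-to }
    where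
    from : ℕ → ℕ
    from = preimage f (word u)
    ∈-mapped : ∀ {Y} → Y ∈ word v → Y ∈ map f (word u)
    ∈-mapped = subst (_ ∈_) (sym map≡)
    to∈ : ∀ {X} → X ∈ word u → f X ∈ word v
    to∈ X∈ = subst (_ ∈_) map≡ (∈-map⁺ f X∈)
    bracket-to : ∀ {X} → X ∈ word u → bracketL τ v (f X) ≈ₚ bracketL τ u X
    bracket-to {X} _ =
      ≈π-trans (Π.concatMap-reindex (factor v (f X)) f inj (alphabet τ u) (alphabet τ v)
                  (alphabet-unique u) (alphabet-unique v)
                  (λ Z Z∈ → ∈-alphabet⁺ {v} (to∈ (∈-alphabet⁻ {u} Z∈)))
                  (λ Y Y∈ → let Z∈ , fZ≡ = preimage-spec f (word u) (∈-mapped (∈-alphabet⁻ {v} Y∈))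
                            in from Y , ∈-alphabet⁺ {u} Z∈ , sym fZ≡))
               (Π.concatMap-cong _ (factor u X) (alphabet τ u)
                  (λ Z Z∈ → Π.≡⇒∼ (cong₂ (powπ τ) (labs Z (∈-alphabet⁻ {u} Z∈))
                                     (trans (cong (λ l → nw τ l (f X) (f Z)) (sym map≡)) (nw-map f inj (word u) X Z)))))

  move3-bijection : ∀ {u v} x y z t A B C → A ≢ B → B ≢ C → A ≢ C → lab u A ≡ lab u B → lab u B ≡ lab u C →
                    word u ≡ x ++ A ∷ B ∷ y ++ A ∷ C ∷ z ++ B ∷ C ∷ t →
                    word v ≡ x ++ B ∷ A ∷ y ++ C ∷ A ∷ z ++ C ∷ B ∷ t →
                    (∀ n → lab u n ≡ lab v n) → LetterBijection u v
  move3-bijection {u} {v} x y z t A B C A≢B B≢C A≢C lab-AB lab-BC u≡ v≡ labs = record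
    { to = λ X → X ; to-injective = λ e → e ; from = λ Y → Y
    ; to∈ = λ {X} → u⊆v X ; from∈ = λ {Y} → v⊆u Y ; to-from = λ _ → refl
    ; lab-to = λ {X} _ → sym (labs X) ; bracket-to = λ {X} _ → ≈π-sym (bracket-same X) }
    where open Move3Brackets u v x y z t A B C A≢B B≢C A≢C lab-AB lab-BC u≡ v≡ labs

  -- States and their values

  module States (invol : ∀ a → τ (τ a) ≡ a) (a : α) where

    Nontrivial : Nanoword α → ℕ → Set
    Nontrivial w X = ¬ (bracketL τ w X ≈ₚ 1π τ)

    MarkSound : Nanoword α → ℕ → Mark → Set
    MarkSound w X onA = lab w X ≡ a × Nontrivial w X
    MarkSound w X onT = lab w X ≡ τ a × Nontrivial w X
    MarkSound w X off = ¬ ((lab w X ≡ a ⊎ lab w X ≡ τ a) × Nontrivial w X)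

    Twins : Nanoword α → ℕ → ℕ → Set
    Twins w X Y = lab w Y ≡ τ (lab w X) × bracketL τ w X ≈ₚ bracketL τ w Y

    StatusSound : (w : Nanoword α) → (ℕ → Status) → ℕ → Status → Set
    StatusSound w st X (marked m) = MarkSound w X m
    StatusSound w st X (paired Y) = Y ≢ X × Y ∈ word w × st Y ≡ paired X × Twins w X Y

    record State (w : Nanoword α) : Set where
      field
        status : ℕ → Status
        sound  : ∀ X → X ∈ word w → StatusSound w status X (status X)

    open State public

    τ-flip : ∀ {x y} → y ≡ τ x → x ≡ τ y
    τ-flip {x} refl = sym (invol x)

    twins-sym : ∀ {w X Y} → Twins w X Y → Twins w Y X
    twins-sym (lab≡ , br≈) = τ-flip lab≡ , ≈π-sym br≈

    mark-transfer : ∀ {u v X Y} m → lab u X ≡ lab v Y → bracketL τ u X ≈ₚ bracketL τ v Y →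
                    MarkSound u X m → MarkSound v Y m
    mark-transfer onA lab≡ br≈ (lab≡a , nt) = trans (sym lab≡) lab≡a , λ triv → nt (≈π-trans br≈ triv)
    mark-transfer onT lab≡ br≈ (lab≡τa , nt) = trans (sym lab≡) lab≡τa , λ triv → nt (≈π-trans br≈ triv)
    mark-transfer off lab≡ br≈ ¬counted (labOK , nt) =
      ¬counted (subst (λ l → l ≡ a ⊎ l ≡ τ a) (sym lab≡) labOK , λ triv → nt (≈π-trans (≈π-sym br≈) triv))

    twins-transfer : ∀ {u v X Y} → lab u X ≡ lab v X → lab u Y ≡ lab v Y →
                     bracketL τ u X ≈ₚ bracketL τ v X → bracketL τ u Y ≈ₚ bracketL τ v Y → Twins u X Y → Twins v X Y
    twins-transfer labX≡ labY≡ brX≈ brY≈ (lab≡ , br≈) =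
      trans (sym labY≡) (trans lab≡ (cong τ labX≡)) , ≈π-trans (≈π-sym brX≈) (≈π-trans br≈ brY≈)

    trivial-off : ∀ {w X} → bracketL τ w X ≈ₚ 1π τ → MarkSound w X off
    trivial-off triv (_ , nt) = nt triv

    partner : ∀ {w} (S : State w) {X Y} → X ∈ word w → status S X ≡ paired Y →
              Y ≢ X × Y ∈ word w × status S Y ≡ paired X × Twins w X Y
    partner {w} S {X} X∈ st≡ = subst (StatusSound w (status S) X) st≡ (sound S X X∈)

    marking : ∀ {w} (S : State w) {X m} → X ∈ word w → status S X ≡ marked m → MarkSound w X m
    marking {w} S {X} X∈ st≡ = subst (StatusSound w (status S) X) st≡ (sound S X X∈)

    record Marking (w : Nanoword α) : Set where
      field
        onA-letters onT-letters : List ℕ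
        onA-unique : Unique onA-letters
        onT-unique : Unique onT-letters
        onA-sound  : ∀ X → X ∈ onA-letters → X ∈ word w × MarkSound w X onA
        onT-sound  : ∀ X → X ∈ onT-letters → X ∈ word w × MarkSound w X onT
        off-sound  : ∀ X → X ∈ word w → X ∉ onA-letters → X ∉ onT-letters → MarkSound w X off
        disjoint   : ∀ X → X ∈ onA-letters → X ∉ onT-letters

    self-dual-marking : ∀ {w} → τ a ≡ a → Support τ w a → Marking w
    self-dual-marking τa≡a S = record
      { onA-letters = letters S ; onT-letters = [] ; onA-unique = unique S ; onT-unique = []
      ; onA-sound = λ X → Equivalence.to (complete S X) ; onT-sound = λ _ ()
      ; off-sound = λ X X∈w X∉S _ (lab≡ , nt) →
          X∉S (Equivalence.from (complete S X) (X∈w , [ (λ l → l) , (λ l → trans l τa≡a) ]′ lab≡ , nt))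
      ; disjoint = λ _ _ () }

    paired-marking : ∀ {w} → τ a ≢ a → Support τ w a → Support τ w (τ a) → Marking w
    paired-marking τa≢a S S′ = record
      { onA-letters = letters S ; onT-letters = letters S′ ; onA-unique = unique S ; onT-unique = unique S′
      ; onA-sound = λ X → Equivalence.to (complete S X) ; onT-sound = λ X → Equivalence.to (complete S′ X)
      ; off-sound = λ X X∈w X∉S X∉S′ (lab≡ , nt) →
          [ (λ l → X∉S (Equivalence.from (complete S X) (X∈w , l , nt)))
          , (λ l → X∉S′ (Equivalence.from (complete S′ X) (X∈w , l , nt))) ]′ lab≡
      ; disjoint = λ X X∈S X∈S′ → τa≢a (trans (sym (proj₁ (proj₂ (Equivalence.to (complete S′ X) X∈S′))))
                                             (proj₁ (proj₂ (Equivalence.to (complete S X) X∈S)))) }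

    -- If τ a ≡ a, a letter labelled a may be marked onA or onT, so the two coefficients must agree.
    module Values (R : Set) (0R : R) (_+R_ : R → R → R) (cA cT : R)
      (cancel : ∀ g → GroupRing._≈_ τ R 0R _+R_ ((cA , g) ∷ (cT , g) ∷ []) [])
      (self-dual : τ a ≡ a → cA ≡ cT) where

      open GroupRing τ R 0R _+R_ public

      ringCongruence : ListCongruence (R × GWord τ)
      ringCongruence = record
        { _∼_ = _≈_ ; ∼-refl = ≈-refl ; ∼-sym = ≈-sym ; ∼-trans = ≈-trans ; ↭⇒∼ = ≈-perm ; ∼-inside = ≈-cong }

      open ListCongruenceProperties ringCongruence public

      markTerm : Mark → GWord τ → Elem
      markTerm onA g = (cA , g) ∷ []
      markTerm onT g = (cT , g) ∷ []
      markTerm off g = []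

      statusTerm : Status → GWord τ → Elem
      statusTerm (marked m) g = markTerm m g
      statusTerm (paired _) g = []

      term : Nanoword α → (ℕ → Status) → ℕ → Elem
      term w st X = statusTerm (st X) (bracketL τ w X)

      value : (w : Nanoword α) → State w → Elem
      value w S = concatMap (term w (status S)) (alphabet τ w)

      markTerm-cong : ∀ m {g h} → g ≈ₚ h → markTerm m g ≈ markTerm m h
      markTerm-cong onA g≈h = ≈-grp cA g≈h
      markTerm-cong onT g≈h = ≈-grp cT g≈h
      markTerm-cong off g≈h = ≈-refl

      statusTerm-cong : ∀ s {g h} → g ≈ₚ h → statusTerm s g ≈ statusTerm s h
      statusTerm-cong (marked m) = markTerm-cong m
      statusTerm-cong (paired _) _ = ≈-refl

      markTerm-unique : ∀ {w X} m n {g} → MarkSound w X m → MarkSound w X n → markTerm m g ≡ markTerm n g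
      markTerm-unique onA onA _ _ = refl
      markTerm-unique onA onT (lab≡a , _) (lab≡τa , _) = cong (λ c → (c , _) ∷ []) (self-dual (trans (sym lab≡τa) lab≡a))
      markTerm-unique onT onA (lab≡τa , _) (lab≡a , _) = cong (λ c → (c , _) ∷ []) (sym (self-dual (trans (sym lab≡τa) lab≡a)))
      markTerm-unique onT onT _ _ = refl
      markTerm-unique off off _ _ = refl
      markTerm-unique onA off (lab≡a , nt) ¬counted = ⊥-elim (¬counted (inj₁ lab≡a , nt))
      markTerm-unique onT off (lab≡τa , nt) ¬counted = ⊥-elim (¬counted (inj₂ lab≡τa , nt))
      markTerm-unique off onA ¬counted (lab≡a , nt) = ⊥-elim (¬counted (inj₁ lab≡a , nt))
      markTerm-unique off onT ¬counted (lab≡τa , nt) = ⊥-elim (¬counted (inj₂ lab≡τa , nt))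

      private
        cancel-swapped : ∀ g → (cT , g) ∷ (cA , g) ∷ [] ≈ []
        cancel-swapped g = ≈-trans (≈-perm (swap _ _ ↭-refl)) (cancel g)

        cancel-doubled : τ a ≡ a → ∀ c g → c ≡ cA ⊎ c ≡ cT → (c , g) ∷ (c , g) ∷ [] ≈ []
        cancel-doubled τa≡a c g (inj₁ refl) = subst (λ d → (cA , g) ∷ (d , g) ∷ [] ≈ []) (sym (self-dual τa≡a)) (cancel g)
        cancel-doubled τa≡a c g (inj₂ refl) = subst (λ d → (d , g) ∷ (cT , g) ∷ [] ≈ []) (self-dual τa≡a) (cancel g)

      twins-cancel : ∀ {w X Y} m n → Twins w X Y → MarkSound w X m → MarkSound w Y n →
                     markTerm m (bracketL τ w X) ++ markTerm n (bracketL τ w Y) ≈ []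
      twins-cancel {w} {X} {Y} m n (lab≡ , br≈) mX nY =
        ≈-trans (++-congˡ (markTerm m (bracketL τ w X)) (markTerm-cong n (≈π-sym br≈))) (marks m n mX nY)
        where
        g = bracketL τ w X
        marks : ∀ m n → MarkSound w X m → MarkSound w Y n → markTerm m g ++ markTerm n g ≈ []
        marks onA onA (X≡a , _) (Y≡a , _) =
          cancel-doubled (trans (sym (trans lab≡ (cong τ X≡a))) Y≡a) cA g (inj₁ refl)
        marks onA onT _ _ = cancel g
        marks onT onA _ _ = cancel-swapped g
        marks onT onT (X≡τa , _) (Y≡τa , _) =
          cancel-doubled (sym (trans (sym (invol a)) (trans (cong τ (sym X≡τa)) (trans (sym lab≡) Y≡τa)))) cT g (inj₂ refl)
        marks off off _ _ = ≈-refl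
        marks onA off (X≡a , nt) ¬counted = ⊥-elim (¬counted (inj₂ (trans lab≡ (cong τ X≡a)) , λ t → nt (≈π-trans br≈ t)))
        marks onT off (X≡τa , nt) ¬counted =
          ⊥-elim (¬counted (inj₁ (trans lab≡ (trans (cong τ X≡τa) (invol a))) , λ t → nt (≈π-trans br≈ t)))
        marks off onA ¬counted (Y≡a , nt) =
          ⊥-elim (¬counted (inj₂ (trans (τ-flip lab≡) (cong τ Y≡a)) , λ t → nt (≈π-trans (≈π-sym br≈) t)))
        marks off onT ¬counted (Y≡τa , nt) =
          ⊥-elim (¬counted (inj₁ (trans (τ-flip lab≡) (trans (cong τ Y≡τa) (invol a))) , λ t → nt (≈π-trans (≈π-sym br≈) t)))

      PairFree : ∀ {w} → State w → Set
      PairFree {w} S = ∀ X → X ∈ word w → ∀ Y → status S X ≢ paired Y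

      module _ {w : Nanoword α} (S S₀ : State w) (pair-free : PairFree S₀) where

        private
          markOf : ∀ {X} → X ∈ word w → ∃[ m ] status S₀ X ≡ marked m × MarkSound w X m
          markOf {X} X∈ with status S₀ X in st≡
          ... | marked m = m , refl , marking S₀ X∈ st≡
          ... | paired Y = ⊥-elim (pair-free X X∈ Y st≡)

          pairedPart′ : Status → ℕ → Elem
          pairedPart′ (marked _) X = []
          pairedPart′ (paired _) X = term w (status S₀) X

          pairedPart : ℕ → Elem
          pairedPart X = pairedPart′ (status S X) X

          split : ∀ X → X ∈ word w → term w (status S₀) X ≈ term w (status S) X ++ pairedPart X
          split X X∈ with status S X in st≡ | markOf X∈
          ... | paired _ | _ = ≈-refl
          ... | marked m | m₀ , st₀≡ , m₀-sound rewrite st₀≡ =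
            ≡⇒∼ (trans (markTerm-unique m₀ m m₀-sound (marking S X∈ st≡)) (sym (++-identityʳ _)))

          pair-cancel : ∀ {X Y} → X ∈ word w → status S X ≡ paired Y → term w (status S₀) X ++ pairedPart Y ≈ []
          pair-cancel {X} {Y} X∈ st≡ with partner S X∈ st≡
          ... | _ , Y∈ , stY≡ , twins with markOf X∈ | markOf Y∈
          ...   | m , stX₀≡ , m-sound | n , stY₀≡ , n-sound
            rewrite stY≡ | stX₀≡ | stY₀≡ = twins-cancel m n twins m-sound n-sound

          pairs-cancel : ∀ n L → length L ≤ n → Unique L → (∀ X → X ∈ L → X ∈ word w) →
                         (∀ X Y → X ∈ L → status S X ≡ paired Y → Y ∈ L) → concatMap pairedPart L ≈ []
          pairs-cancel n       []      _         _              _    _      = ≈-refl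
          pairs-cancel (suc n) (X ∷ L) (s≤s len) u@(_ ∷ uL) L⊆w closed with status S X in st≡
          ... | marked m = pairs-cancel n L len uL (λ Z Z∈ → L⊆w Z (there Z∈)) closed′
            where
            closed′ : ∀ Z W → Z ∈ L → status S Z ≡ paired W → W ∈ L
            closed′ Z W Z∈ stZ≡ with closed Z W (there Z∈) stZ≡
            ... | there W∈ = W∈
            ... | here refl with () ← trans (sym st≡) (proj₁ (proj₂ (proj₂ (partner S (L⊆w Z (there Z∈)) stZ≡))))
          ... | paired Y =
            ≈-trans (++-congˡ (term w (status S₀) X) (≈-perm (concatMap-↭ pairedPart (↭-remove uL Y∈L))))
            (≈-trans (≡⇒∼ (sym (++-assoc (term w (status S₀) X) (pairedPart Y) _)))
            (≈-trans (++-congʳ _ (pair-cancel X∈ st≡))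
                     (pairs-cancel n (remove Y L) shorter (remove-unique uL)
                        (λ Z Z∈ → L⊆w Z (there (proj₁ (∈-remove⁻ L Z∈)))) closed′)))
            where
            X∈ = L⊆w X (here refl)
            Y≢X = proj₁ (partner S X∈ st≡)
            stY≡ = proj₁ (proj₂ (proj₂ (partner S X∈ st≡)))
            Y∈L : Y ∈ L
            Y∈L with closed X Y (here refl) st≡
            ... | here Y≡X = ⊥-elim (Y≢X Y≡X)
            ... | there Y∈ = Y∈
            shorter : length (remove Y L) ≤ n
            shorter = ≤-trans (n≤1+n _) (subst (_≤ n) (↭-length (↭-remove uL Y∈L)) len)
            closed′ : ∀ Z W → Z ∈ remove Y L → status S Z ≡ paired W → W ∈ remove Y L
            closed′ Z W Z∈ stZ≡ with ∈-remove⁻ L Z∈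
            ... | Z∈L , Z≢Y with closed Z W (there Z∈L) stZ≡ | partner S (L⊆w Z (there Z∈L)) stZ≡
            ...   | here refl | _ , _ , stX≡ , _ = ⊥-elim (Z≢Y (paired-injective (trans (sym stX≡) st≡)))
            ...   | there W∈L | _ , _ , stW≡ , _ = ∈-remove⁺ W∈L W≢Y
              where
              W≢Y : W ≢ Y
              W≢Y refl = Unique[x∷xs]⇒x∉xs u (subst (_∈ L) (paired-injective (trans (sym stW≡) stY≡)) Z∈L)

        value-pair-free : value w S ≈ value w S₀
        value-pair-free = ≈-sym (
          ≈-trans (concatMap-cong _ _ (alphabet τ w) (λ X X∈ → split X (∈-alphabet⁻ {w} X∈)))
          (≈-trans (≈-perm (concatMap-++ (term w (status S)) pairedPart (alphabet τ w)))
          (≈-trans (++-congˡ (value w S)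
                      (pairs-cancel _ (alphabet τ w) ≤-refl (alphabet-unique w) (λ X X∈ → ∈-alphabet⁻ {w} X∈)
                         (λ X Y X∈ st≡ → ∈-alphabet⁺ {w} (proj₁ (proj₂ (partner S (∈-alphabet⁻ {w} X∈) st≡))))))
                   (≡⇒∼ (++-identityʳ _)))))

      -- Transport of states along homotopies

      Transport : Nanoword α → Nanoword α → Set
      Transport u v = (S : State u) → Σ (State v) (λ S′ → value u S ≈ value v S′)

      statusTerm-relabel : ∀ f s g → statusTerm (relabel f s) g ≡ statusTerm s g
      statusTerm-relabel f (marked m) g = refl
      statusTerm-relabel f (paired _) g = refl

      module _ {u v : Nanoword α} (β : LetterBijection u v) where
        open LetterBijection β

        transport-to : Transport u v
        transport-to S = record { status = st′ ; sound = sound′ } , value≈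
          where
          st′ : ℕ → Status
          st′ Y = relabel to (status S (from Y))

          st′-to : ∀ {X} → X ∈ word u → st′ (to X) ≡ relabel to (status S X)
          st′-to X∈ = cong (λ Z → relabel to (status S Z)) (from-to X∈)

          sound-to : ∀ X → X ∈ word u → StatusSound v st′ (to X) (relabel to (status S X))
          sound-to X X∈ with status S X in st≡
          ... | marked m = mark-transfer m (sym (lab-to X∈)) (≈π-sym (bracket-to X∈)) (marking S X∈ st≡)
          ... | paired Z with partner S X∈ st≡
          ...   | Z≢X , Z∈ , stZ≡ , lab≡ , br≈ =
            (λ e → Z≢X (to-injective e)) , to∈ Z∈ , trans (st′-to Z∈) (cong (relabel to) stZ≡) ,
            trans (lab-to Z∈) (trans lab≡ (cong τ (sym (lab-to X∈)))) ,
            ≈π-trans (bracket-to X∈) (≈π-trans br≈ (≈π-sym (bracket-to Z∈)))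

          sound′ : ∀ Y → Y ∈ word v → StatusSound v st′ Y (st′ Y)
          sound′ Y Y∈ = subst (λ Y → StatusSound v st′ Y (st′ Y)) (to-from Y∈)
                          (subst (StatusSound v st′ (to (from Y))) (sym (st′-to (from∈ Y∈))) (sound-to (from Y) (from∈ Y∈)))

          value≈ : value u S ≈ concatMap (term v st′) (alphabet τ v)
          value≈ = ≈-sym (≈-trans (concatMap-alphabet ringCongruence (term v st′))
                     (concatMap-cong _ _ (alphabet τ u) λ X X∈ → let X∈u = ∈-alphabet⁻ {u} X∈ in
                       subst (_≈ term u (status S) X)
                             (sym (trans (cong (λ s → statusTerm s (bracketL τ v (to X))) (st′-to X∈u))
                                         (statusTerm-relabel to (status S X) _)))
                             (statusTerm-cong (status S X) (bracket-to X∈u))))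

        transport-from : Transport v u
        transport-from S = record { status = st′ ; sound = sound′ } , value≈
          where
          st′ : ℕ → Status
          st′ X = relabel from (status S (to X))

          sound′ : ∀ X → X ∈ word u → StatusSound u st′ X (st′ X)
          sound′ X X∈ with status S (to X) in st≡
          ... | marked m = mark-transfer m (lab-to X∈) (bracket-to X∈) (marking S (to∈ X∈) st≡)
          ... | paired Y with partner S (to∈ X∈) st≡
          ...   | Y≢toX , Y∈ , stY≡ , lab≡ , br≈ =
            (λ e → Y≢toX (trans (sym (to-from Y∈)) (cong to e))) , from∈ Y∈ ,
            trans (cong (λ Z → relabel from (status S Z)) (to-from Y∈))
                  (trans (cong (relabel from) stY≡) (cong paired (from-to X∈))) ,
            trans (sym (lab-to (from∈ Y∈))) (trans (cong (lab v) (to-from Y∈)) (trans lab≡ (cong τ (lab-to X∈)))) ,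
            ≈π-trans (≈π-sym (bracket-to X∈))
              (≈π-trans br≈ (subst (λ Z → bracketL τ v Z ≈ₚ bracketL τ u (from Y)) (to-from Y∈) (bracket-to (from∈ Y∈))))

          value≈ : value v S ≈ concatMap (term u st′) (alphabet τ u)
          value≈ = ≈-trans (concatMap-alphabet ringCongruence (term v (status S)))
                     (concatMap-cong _ _ (alphabet τ u) λ X X∈ →
                       subst (statusTerm (status S (to X)) (bracketL τ v (to X)) ≈_)
                             (sym (statusTerm-relabel from (status S (to X)) _))
                             (statusTerm-cong (status S (to X)) (bracket-to (∈-alphabet⁻ {u} X∈))))

      statusTerm-unpair : ∀ A s g → statusTerm (unpair A s) g ≡ statusTerm s g
      statusTerm-unpair A (marked m) g = refl
      statusTerm-unpair A (paired Y) g with Y ≟ A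
      ... | yes _ = refl
      ... | no _  = refl

      trivial-term : ∀ {w} (S : State w) {X} → X ∈ word w → bracketL τ w X ≈ₚ 1π τ → term w (status S) X ≈ []
      trivial-term S {X} X∈ triv with status S X in st≡
      ... | paired _ = ≈-refl
      ... | marked m with m | marking S X∈ st≡
      ...   | onA | _ , nt = ⊥-elim (nt triv)
      ...   | onT | _ , nt = ⊥-elim (nt triv)
      ...   | off | _      = ≈-refl

      module Move1Transport (u v : Nanoword α) (x y : List ℕ) (A : ℕ)
        (u≡ : word u ≡ x ++ A ∷ A ∷ y) (v≡ : word v ≡ x ++ y) (labs : ∀ n → lab u n ≡ lab v n) where

        open Move1Brackets u v x y A u≡ v≡ labs

        private
          ≢A : ∀ {X} → X ∈ word v → X ≢ A
          ≢A X∈v refl = A∉v X∈v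

          bracket-v : ∀ {X} → X ∈ word v → bracketL τ u X ≈ₚ bracketL τ v X
          bracket-v X∈v = bracket-kept _ (≢A X∈v)

        transport-forward : Transport u v
        transport-forward S = record { status = st′ ; sound = sound′ } , value≈
          where
          st′ : ℕ → Status
          st′ X = unpair A (status S X)

          sound′ : ∀ X → X ∈ word v → StatusSound v st′ X (unpair A (status S X))
          sound′ X X∈v with status S X in st≡
          ... | marked m = mark-transfer {u} {v} m (labs X) (bracket-v X∈v) (marking S (v⊆u X X∈v) st≡)
          ... | paired Y with Y ≟ A | partner S (v⊆u X X∈v) st≡
          ...   | yes refl | _ , _ , _ , _ , br≈ = trivial-off {v} {X} (≈π-trans (≈π-sym (bracket-v X∈v)) (≈π-trans br≈ A-trivial))
          ...   | no Y≢A   | Y≢X , Y∈u , stY≡ , twins =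
            Y≢X , Y∈v , trans (cong (unpair A) stY≡) (unpair-other (≢A X∈v)) ,
            twins-transfer {u} {v} (labs X) (labs Y) (bracket-v X∈v) (bracket-v Y∈v) twins
            where
            Y∈v = u⊆v Y Y∈u Y≢A

          value≈ : value u S ≈ concatMap (term v st′) (alphabet τ v)
          value≈ = concatMap-cong-overlap _ _ (alphabet τ u) (alphabet τ v) (alphabet-unique u) (alphabet-unique v)
            (λ X _ X∈ → subst (term u (status S) X ≈_) (sym (statusTerm-unpair A (status S X) _))
                          (statusTerm-cong (status S X) (bracket-v (∈-alphabet⁻ {v} X∈))))
            (λ X X∈ X∉ → let X∈u = ∈-alphabet⁻ {u} X∈ ; X≡A = deleted≡A X X∈u (λ X∈v → X∉ (∈-alphabet⁺ {v} X∈v)) in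
               trivial-term S X∈u (subst (λ Z → bracketL τ u Z ≈ₚ 1π τ) (sym X≡A) A-trivial))
            (λ X X∈ X∉ → ⊥-elim (X∉ (∈-alphabet⁺ {u} (v⊆u X (∈-alphabet⁻ {v} X∈)))))

        transport-backward : Transport v u
        transport-backward S = record { status = st′ ; sound = sound′ } , value≈
          where
          st′ : ℕ → Status
          st′ X with X ≟ A
          ... | yes _ = marked off
          ... | no _  = status S X

          st′-kept : ∀ {X} → X ≢ A → st′ X ≡ status S X
          st′-kept {X} X≢A with X ≟ A
          ... | yes X≡A = ⊥-elim (X≢A X≡A)
          ... | no _    = refl

          sound-kept : ∀ X → X ∈ word v → StatusSound u st′ X (status S X)
          sound-kept X X∈v with status S X in st≡
          ... | marked m = mark-transfer {v} {u} m (sym (labs X)) (≈π-sym (bracket-v X∈v)) (marking S X∈v st≡)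
          ... | paired Y with partner S X∈v st≡
          ...   | Y≢X , Y∈v , stY≡ , twins =
            Y≢X , v⊆u Y Y∈v , trans (st′-kept (≢A Y∈v)) stY≡ ,
            twins-transfer {v} {u} (sym (labs X)) (sym (labs Y)) (≈π-sym (bracket-v X∈v)) (≈π-sym (bracket-v Y∈v)) twins

          sound′ : ∀ X → X ∈ word u → StatusSound u st′ X (st′ X)
          sound′ X X∈u with X ≟ A
          ... | yes refl = trivial-off {u} {A} A-trivial
          ... | no X≢A  = sound-kept X (u⊆v X X∈u X≢A)

          value≈ : value v S ≈ concatMap (term u st′) (alphabet τ u)
          value≈ = concatMap-cong-overlap _ _ (alphabet τ v) (alphabet τ u) (alphabet-unique v) (alphabet-unique u)
            (λ X X∈ _ → let X∈v = ∈-alphabet⁻ {v} X∈ in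
               subst (term v (status S) X ≈_) (cong (λ s → statusTerm s (bracketL τ u X)) (sym (st′-kept (≢A X∈v))))
                     (statusTerm-cong (status S X) (≈π-sym (bracket-v X∈v))))
            (λ X X∈ X∉ → ⊥-elim (X∉ (∈-alphabet⁺ {u} (v⊆u X (∈-alphabet⁻ {v} X∈)))))
            (λ X X∈ X∉ → ≡⇒∼ (cong (λ s → statusTerm s (bracketL τ u X)) (st′-deleted X X∈ X∉)))
            where
            st′-deleted : ∀ X → X ∈ alphabet τ u → X ∉ alphabet τ v → st′ X ≡ marked off
            st′-deleted X X∈ X∉ with X ≟ A
            ... | yes _  = refl
            ... | no X≢A = ⊥-elim (X∉ (∈-alphabet⁺ {v} (u⊆v X (∈-alphabet⁻ {u} X∈) X≢A)))

      module Move2Transport (u v : Nanoword α) (x y z : List ℕ) (A B : ℕ)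
        (u≡ : word u ≡ x ++ A ∷ B ∷ y ++ B ∷ A ∷ z) (v≡ : word v ≡ x ++ y ++ z)
        (labs : ∀ n → lab u n ≡ lab v n) (lab-B : lab u B ≡ τ (lab u A)) where

        open Move2Brackets u v x y z A B u≡ v≡ labs lab-B

        private
          twins-AB : Twins u A B
          twins-AB = lab-B , twins-bracket

          ≢A : ∀ {X} → X ∈ word v → X ≢ A
          ≢A X∈v refl = A∉v X∈v

          ≢B : ∀ {X} → X ∈ word v → X ≢ B
          ≢B X∈v refl = B∉v X∈v

          bracket-v : ∀ {X} → X ∈ word v → bracketL τ u X ≈ₚ bracketL τ v X
          bracket-v X∈v = bracket-kept _ (≢A X∈v) (≢B X∈v)

        transport-backward : Transport v u
        transport-backward S = record { status = st′ ; sound = sound′ } , value≈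
          where
          st′ : ℕ → Status
          st′ X with X ≟ A
          ... | yes _ = paired B
          ... | no _ with X ≟ B
          ...   | yes _ = paired A
          ...   | no _  = status S X

          st′-A : st′ A ≡ paired B
          st′-A with A ≟ A
          ... | yes _ = refl
          ... | no A≢A = ⊥-elim (A≢A refl)

          st′-B : st′ B ≡ paired A
          st′-B with B ≟ A
          ... | yes B≡A = ⊥-elim (A≢B (sym B≡A))
          ... | no _ with B ≟ B
          ...   | yes _ = refl
          ...   | no B≢B = ⊥-elim (B≢B refl)

          st′-kept : ∀ {X} → X ∈ word v → st′ X ≡ status S X
          st′-kept {X} X∈v with X ≟ A
          ... | yes X≡A = ⊥-elim (≢A X∈v X≡A)
          ... | no _ with X ≟ B
          ...   | yes X≡B = ⊥-elim (≢B X∈v X≡B)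
          ...   | no _    = refl

          sound-kept : ∀ X → X ∈ word v → StatusSound u st′ X (status S X)
          sound-kept X X∈v with status S X in st≡
          ... | marked m = mark-transfer {v} {u} m (sym (labs X)) (≈π-sym (bracket-v X∈v)) (marking S X∈v st≡)
          ... | paired Y with partner S X∈v st≡
          ...   | Y≢X , Y∈v , stY≡ , twins =
            Y≢X , v⊆u Y Y∈v , trans (st′-kept Y∈v) stY≡ ,
            twins-transfer {v} {u} (sym (labs X)) (sym (labs Y)) (≈π-sym (bracket-v X∈v)) (≈π-sym (bracket-v Y∈v)) twins

          sound′ : ∀ X → X ∈ word u → StatusSound u st′ X (st′ X)
          sound′ X X∈u with X ≟ A
          ... | yes refl = ≢-sym A≢B , B∈u , st′-B , twins-AB
          ... | no X≢A with X ≟ B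
          ...   | yes refl = A≢B , A∈u , st′-A , twins-sym {u} twins-AB
          ...   | no X≢B = sound-kept X (u⊆v X X∈u X≢A X≢B)

          value≈ : value v S ≈ concatMap (term u st′) (alphabet τ u)
          value≈ = concatMap-cong-overlap _ _ (alphabet τ v) (alphabet τ u) (alphabet-unique v) (alphabet-unique u)
            (λ X X∈ _ → let X∈v = ∈-alphabet⁻ {v} X∈ in
               subst (term v (status S) X ≈_) (cong (λ s → statusTerm s (bracketL τ u X)) (sym (st′-kept X∈v)))
                     (statusTerm-cong (status S X) (≈π-sym (bracket-v X∈v))))
            (λ X X∈ X∉ → ⊥-elim (X∉ (∈-alphabet⁺ {u} (v⊆u X (∈-alphabet⁻ {v} X∈)))))
            (λ X X∈ X∉ → [ (λ { refl → ≡⇒∼ (cong (λ s → statusTerm s (bracketL τ u A)) st′-A) })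
                         , (λ { refl → ≡⇒∼ (cong (λ s → statusTerm s (bracketL τ u B)) st′-B) }) ]′
                         (deleted≡A⊎B X (∈-alphabet⁻ {u} X∈) (λ X∈v → X∉ (∈-alphabet⁺ {v} X∈v))))

        module Forward (S : State u) where

          st′ : ℕ → Status
          st′ X = splice A B (status S) (status S X)

          private
            inherit : ∀ {X P Q} → X ∈ word v → status S X ≡ paired P → Twins u P Q → P ≢ Q → Q ∈ word u → Q ∉ word v →
                      (∀ Z → Z ∈ word u → Z ≢ P → Z ≢ Q → Z ∈ word v) →
                      splice A B (status S) (paired Q) ≡ status S P → StatusSound v st′ X (status S Q)
            inherit {X} {P} {Q} X∈v stX≡ (labQ≡ , brPQ) P≢Q Q∈u Q∉v kept splice-Q with partner S (v⊆u X X∈v) stX≡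
            ... | _ , P∈u , stP≡ , labP≡ , brXP with status S Q in stQ≡
            ...   | marked m = mark-transfer {u} {v} m labQX (≈π-trans (≈π-sym brPQ) (≈π-trans (≈π-sym brXP) (bracket-v X∈v)))
                                 (marking S Q∈u stQ≡)
              where
              labQX : lab u Q ≡ lab v X
              labQX = trans labQ≡ (trans (cong τ labP≡) (trans (invol _) (labs X)))
            ...   | paired Z with partner S Q∈u stQ≡
            ...     | Z≢Q , Z∈u , stZ≡ , labZ≡ , brQZ = Z≢X , Z∈v , stZ′≡ , labs′ , brs′
              where
              Z≢P : Z ≢ P
              Z≢P refl = Q∉v (subst (_∈ word v) (paired-injective (trans (sym stP≡) stZ≡)) X∈v)
              Z∈v = kept Z Z∈u Z≢P Z≢Q
              Z≢X : Z ≢ X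
              Z≢X refl = P≢Q (paired-injective (trans (sym stX≡) stZ≡))
              stZ′≡ : st′ Z ≡ paired X
              stZ′≡ = trans (cong (splice A B (status S)) stZ≡) (trans splice-Q stP≡)
              labs′ : lab v Z ≡ τ (lab v X)
              labs′ = trans (sym (labs Z)) (trans labZ≡ (trans (cong τ labQ≡) (trans (cong τ (cong τ labP≡))
                        (trans (cong τ (invol _)) (cong τ (labs X))))))
              brs′ : bracketL τ v X ≈ₚ bracketL τ v Z
              brs′ = ≈π-trans (≈π-sym (bracket-v X∈v)) (≈π-trans brXP (≈π-trans brPQ (≈π-trans brQZ (bracket-v Z∈v))))

          sound′ : ∀ X → X ∈ word v → StatusSound v st′ X (st′ X)
          sound′ X X∈v with status S X in st≡
          ... | marked m = mark-transfer {u} {v} m (labs X) (bracket-v X∈v) (marking S (v⊆u X X∈v) st≡)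
          ... | paired Y with Y ≟ A
          ...   | yes refl = inherit X∈v st≡ twins-AB A≢B B∈u B∉v (λ Z Z∈ Z≢A Z≢B → u⊆v Z Z∈ Z≢A Z≢B)
                                 (splice-right (status S) A≢B)
          ...   | no Y≢A with Y ≟ B
          ...     | yes refl = inherit X∈v st≡ (twins-sym {u} twins-AB) (≢-sym A≢B) A∈u A∉v
                                   (λ Z Z∈ Z≢B Z≢A → u⊆v Z Z∈ Z≢A Z≢B) (splice-left A B (status S))
          ...     | no Y≢B with partner S (v⊆u X X∈v) st≡
          ...       | Y≢X , Y∈u , stY≡ , twins =
            Y≢X , Y∈v , trans (cong (splice A B (status S)) stY≡) (splice-other (status S) (≢A X∈v) (≢B X∈v)) ,
            twins-transfer {u} {v} (labs X) (labs Y) (bracket-v X∈v) (bracket-v Y∈v) twins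
            where
            Y∈v = u⊆v Y Y∈u Y≢A Y≢B

          state : State v
          state = record { status = st′ ; sound = sound′ }

          private
            term-kept : ∀ X → X ∈ word v →
                        (status S X ≡ paired A → statusTerm (status S B) (bracketL τ v X) ≡ []) →
                        (status S X ≡ paired B → statusTerm (status S A) (bracketL τ v X) ≡ []) →
                        term u (status S) X ≈ term v st′ X
            term-kept X X∈v via-A via-B with status S X in st≡
            ... | marked m = markTerm-cong m (bracket-v X∈v)
            ... | paired Y with Y ≟ A
            ...   | yes refl = ≡⇒∼ (sym (via-A refl))
            ...   | no _ with Y ≟ B
            ...     | yes refl = ≡⇒∼ (sym (via-B refl))
            ...     | no _     = ≈-refl

            not-partner : ∀ {X P m} → X ∈ word v → status S P ≡ marked m → status S X ≢ paired P
            not-partner X∈v stP≡ stX≡ with () ← trans (sym stP≡) (proj₁ (proj₂ (proj₂ (partner S (v⊆u _ X∈v) stX≡))))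

            deleted-∉ : ∀ {X} → X ∈ alphabet τ u → X ∉ alphabet τ v → X ≡ A ⊎ X ≡ B
            deleted-∉ X∈ X∉ = deleted≡A⊎B _ (∈-alphabet⁻ {u} X∈) (λ X∈v → X∉ (∈-alphabet⁺ {v} X∈v))

            v⊆u-alphabet : ∀ X → X ∈ alphabet τ v → X ∉ alphabet τ u → term v st′ X ≈ []
            v⊆u-alphabet X X∈ X∉ = ⊥-elim (X∉ (∈-alphabet⁺ {u} (v⊆u X (∈-alphabet⁻ {v} X∈))))

            both-paired : ∀ {Y Z} → status S A ≡ paired Y → status S B ≡ paired Z → value u S ≈ value v state
            both-paired stA≡ stB≡ =
              concatMap-cong-overlap _ _ (alphabet τ u) (alphabet τ v) (alphabet-unique u) (alphabet-unique v)
                (λ X _ X∈ → term-kept X (∈-alphabet⁻ {v} X∈) (λ _ → cong (λ s → statusTerm s _) stB≡)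
                                                               (λ _ → cong (λ s → statusTerm s _) stA≡))
                (λ X X∈ X∉ → [ (λ { refl → ≡⇒∼ (cong (λ s → statusTerm s _) stA≡) })
                             , (λ { refl → ≡⇒∼ (cong (λ s → statusTerm s _) stB≡) }) ]′ (deleted-∉ X∈ X∉))
                v⊆u-alphabet

            both-marked : ∀ {m n} → status S A ≡ marked m → status S B ≡ marked n → value u S ≈ value v state
            both-marked {m} {n} stA≡ stB≡ =
              concatMap-cong-except _ _ (alphabet τ u) (alphabet τ v) (A ∷ B ∷ []) []
                (alphabet-unique u) (alphabet-unique v) ((A≢B ∷ []) ∷ [] ∷ []) []
                (λ { _ (here refl) → ∈-alphabet⁺ {u} A∈u ; _ (there (here refl)) → ∈-alphabet⁺ {u} B∈u }) (λ _ ())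
                cancelAB kept
                (λ X X∈ X∉ → ≡⇒∼ (outside-∈ (A ∷ B ∷ []) (term u (status S))
                   ([ (λ { refl → here refl }) , (λ { refl → there (here refl) }) ]′ (deleted-∉ X∈ X∉))))
                (λ X X∈ X∉ → ⊥-elim (X∉ (∈-alphabet⁺ {u} (v⊆u X (∈-alphabet⁻ {v} X∈)))))
              where
              cancelAB : term u (status S) A ++ term u (status S) B ++ [] ≈ []
              cancelAB rewrite ++-identityʳ (term u (status S) B) | stA≡ | stB≡ =
                twins-cancel m n twins-AB (marking S A∈u stA≡) (marking S B∈u stB≡)
              kept : ∀ X → X ∈ alphabet τ u → X ∈ alphabet τ v →
                     outside (A ∷ B ∷ []) (term u (status S)) X ≈ outside [] (term v st′) X
              kept X _ X∈ rewrite outside-∉ (A ∷ B ∷ []) (term u (status S)) {X}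
                                    (λ { (here refl) → A∉v (∈-alphabet⁻ {v} X∈) ; (there (here refl)) → B∉v (∈-alphabet⁻ {v} X∈) }) =
                term-kept X (∈-alphabet⁻ {v} X∈) (λ stX≡ → ⊥-elim (not-partner (∈-alphabet⁻ {v} X∈) stA≡ stX≡))
                                                 (λ stX≡ → ⊥-elim (not-partner (∈-alphabet⁻ {v} X∈) stB≡ stX≡))

            one-marked : ∀ {P Q m Z} → status S P ≡ marked m → status S Q ≡ paired Z →
                         P ∈ word u → Q ∈ word u → P ∉ word v → Q ∉ word v → P ≢ Q → Twins u P Q →
                         (∀ {Y} → Y ≡ A ⊎ Y ≡ B → Y ≡ P ⊎ Y ≡ Q) →
                         (∀ W → W ∈ word u → W ≢ P → W ≢ Q → W ∈ word v) →
                         splice A B (status S) (paired Q) ≡ status S P → value u S ≈ value v state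
            one-marked {P} {Q} {m} {Z} stP≡ stQ≡ P∈u Q∈u P∉v Q∉v P≢Q (_ , brPQ) AB⇒PQ kept splice-Q =
              concatMap-cong-except _ _ (alphabet τ u) (alphabet τ v) (P ∷ []) (Z ∷ [])
                (alphabet-unique u) (alphabet-unique v) ([] ∷ []) ([] ∷ [])
                (λ { _ (here refl) → ∈-alphabet⁺ {u} P∈u }) (λ { _ (here refl) → ∈-alphabet⁺ {v} Z∈v })
                (++-congʳ [] inherited) common deleted
                (λ X X∈ X∉ → ⊥-elim (X∉ (∈-alphabet⁺ {u} (v⊆u X (∈-alphabet⁻ {v} X∈)))))
              where
              Z-partner = partner S Q∈u stQ≡
              stZ≡ = proj₁ (proj₂ (proj₂ Z-partner))
              Z≢P : Z ≢ P
              Z≢P refl with () ← trans (sym stP≡) stZ≡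
              Z∈v = kept Z (proj₁ (proj₂ Z-partner)) Z≢P (proj₁ Z-partner)
              inherited : term u (status S) P ≈ term v st′ Z
              inherited = subst (λ s → term u (status S) P ≈ statusTerm s (bracketL τ v Z))
                                (sym (trans (cong (splice A B (status S)) stZ≡) splice-Q))
                                (statusTerm-cong (status S P)
                                   (≈π-trans brPQ (≈π-trans (proj₂ (proj₂ (proj₂ (proj₂ Z-partner)))) (bracket-v Z∈v))))
              unpartnered : ∀ {X Y} → X ∈ word v → X ≢ Z → status S X ≡ paired Y → Y ≡ P ⊎ Y ≡ Q → ⊥
              unpartnered X∈v X≢Z stX≡ (inj₁ refl) = not-partner X∈v stP≡ stX≡
              unpartnered X∈v X≢Z stX≡ (inj₂ refl) =
                X≢Z (paired-injective (trans (sym (proj₁ (proj₂ (proj₂ (partner S (v⊆u _ X∈v) stX≡))))) stQ≡))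
              common : ∀ X → X ∈ alphabet τ u → X ∈ alphabet τ v →
                       outside (P ∷ []) (term u (status S)) X ≈ outside (Z ∷ []) (term v st′) X
              common X _ X∈ rewrite outside-∉ (P ∷ []) (term u (status S)) {X} (λ { (here refl) → P∉v (∈-alphabet⁻ {v} X∈) })
                with X ≟ Z
              ... | yes refl rewrite stZ≡ = ≈-refl
              ... | no X≢Z =
                term-kept X X∈v (λ stX≡ → ⊥-elim (unpartnered X∈v X≢Z stX≡ (AB⇒PQ (inj₁ refl))))
                                (λ stX≡ → ⊥-elim (unpartnered X∈v X≢Z stX≡ (AB⇒PQ (inj₂ refl))))
                where X∈v = ∈-alphabet⁻ {v} X∈
              deleted : ∀ X → X ∈ alphabet τ u → X ∉ alphabet τ v → outside (P ∷ []) (term u (status S)) X ≈ []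
              deleted X X∈ X∉ with AB⇒PQ (deleted-∉ X∈ X∉)
              ... | inj₁ refl = ≡⇒∼ (outside-∈ (P ∷ []) (term u (status S)) (here refl))
              ... | inj₂ refl rewrite outside-∉ (P ∷ []) (term u (status S)) {Q} (λ { (here refl) → P≢Q refl }) | stQ≡ = ≈-refl

          value≈ : value u S ≈ value v state
          value≈ with status S A in stA≡ | status S B in stB≡
          ... | paired _ | paired _ = both-paired stA≡ stB≡
          ... | marked _ | marked _ = both-marked stA≡ stB≡
          ... | marked _ | paired _ =
            one-marked stA≡ stB≡ A∈u B∈u A∉v B∉v A≢B twins-AB (λ AB → AB) (λ W W∈ W≢A W≢B → u⊆v W W∈ W≢A W≢B)
                       (splice-right (status S) A≢B)
          ... | paired _ | marked _ =
            one-marked stB≡ stA≡ B∈u A∈u B∉v A∉v (≢-sym A≢B) (twins-sym {u} twins-AB) [ inj₂ , inj₁ ]′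
                       (λ W W∈ W≢B W≢A → u⊆v W W∈ W≢A W≢B) (splice-left A B (status S))

        transport-forward : Transport u v
        transport-forward S = Forward.state S , Forward.value≈ S

      step-transport : ∀ {u v} → Step τ u v → Transport u v × Transport v u
      step-transport (isoStep i) = transport-to (iso-bijection i) , transport-from (iso-bijection i)
      step-transport {u} {v} (moveStep (move1 x y A u≡ v≡ labs)) = transport-forward , transport-backward
        where open Move1Transport u v x y A u≡ v≡ labs
      step-transport {u} {v} (moveStep (move2 x y z A B lab-B u≡ v≡ labs)) = transport-forward , transport-backward
        where open Move2Transport u v x y z A B u≡ v≡ labs lab-B
      step-transport (moveStep (move3 x y z t A B C A≢B B≢C A≢C lab-AB lab-BC u≡ v≡ labs)) =
        transport-to β , transport-from β
        where β = move3-bijection x y z t A B C A≢B B≢C A≢C lab-AB lab-BC u≡ v≡ labs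

      homotopy-transport : ∀ {u v} → Homotopic τ u v → Transport u v
      homotopy-transport ε           S = S , ≈-refl
      homotopy-transport (fwd s ◅ h) S =
        let S₁ , e₁ = proj₁ (step-transport s) S ; S₂ , e₂ = homotopy-transport h S₁ in S₂ , ≈-trans e₁ e₂
      homotopy-transport (bwd s ◅ h) S =
        let S₁ , e₁ = proj₂ (step-transport s) S ; S₂ , e₂ = homotopy-transport h S₁ in S₂ , ≈-trans e₁ e₂

      value-homotopy-invariant : ∀ {u v} → Homotopic τ u v → (S : State u) (S₀ : State v) → PairFree S₀ →
                                 value u S ≈ value v S₀
      value-homotopy-invariant h S S₀ pair-free =
        let S′ , e = homotopy-transport h S in ≈-trans e (value-pair-free S′ S₀ pair-free)

      markedSum : ∀ {w} → Marking w → Elem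
      markedSum {w} M = map (λ X → (cA , bracketL τ w X)) (Marking.onA-letters M) ++
                        map (λ X → (cT , bracketL τ w X)) (Marking.onT-letters M)

      module _ {w : Nanoword α} (M : Marking w) where
        open Marking M renaming (onA-letters to LA; onT-letters to LT; onA-unique to uA; onT-unique to uT)

        markOf : ℕ → Mark
        markOf X with X ∈? LA | X ∈? LT
        ... | yes _ | _     = onA
        ... | no _  | yes _ = onT
        ... | no _  | no _  = off

        listState : State w
        listState = record { status = λ X → marked (markOf X) ; sound = sound′ }
          where
          sound′ : ∀ X → X ∈ word w → MarkSound w X (markOf X)
          sound′ X X∈ with X ∈? LA | X ∈? LT
          ... | yes X∈A | _       = proj₂ (onA-sound X X∈A)
          ... | no _    | yes X∈T = proj₂ (onT-sound X X∈T)
          ... | no X∉A  | no X∉T  = off-sound X X∈ X∉A X∉T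

        listState-pair-free : PairFree listState
        listState-pair-free X _ Y ()

        value-listState : value w listState ≈ markedSum M
        value-listState =
          ≈-trans (concatMap-cong _ (λ X → only LA onA X ++ only LT onT X) (alphabet τ w) (λ X _ → ≡⇒∼ (split X)))
          (≈-trans (≈-perm (concatMap-++ (only LA onA) (only LT onT) (alphabet τ w)))
                   (++-cong (≈-trans (collect LA uA onA λ X X∈ → proj₁ (onA-sound X X∈)) (≡⇒∼ (concatMap-singleton _ LA)))
                            (≈-trans (collect LT uT onT λ X X∈ → proj₁ (onT-sound X X∈)) (≡⇒∼ (concatMap-singleton _ LT)))))
          where
          only : List ℕ → Mark → ℕ → Elem
          only L m X with X ∈? L
          ... | yes _ = markTerm m (bracketL τ w X)
          ... | no _  = []
          split : ∀ X → markTerm (markOf X) (bracketL τ w X) ≡ only LA onA X ++ only LT onT X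
          split X with X ∈? LA | X ∈? LT
          ... | yes X∈A | yes X∈T = ⊥-elim (disjoint X X∈A X∈T)
          ... | yes _   | no _    = refl
          ... | no _    | yes _   = refl
          ... | no _    | no _    = refl
          collect : ∀ L → Unique L → ∀ m → (∀ X → X ∈ L → X ∈ word w) →
                    concatMap (only L m) (alphabet τ w) ≈ concatMap (λ X → markTerm m (bracketL τ w X)) L
          collect L uL m L⊆w = concatMap-cong-overlap _ _ (alphabet τ w) L (alphabet-unique w) uL
            (λ X _ X∈L → ≡⇒∼ (only-∈ X∈L)) (λ X _ X∉L → ≡⇒∼ (only-∉ X∉L))
            (λ X X∈L X∉ → ⊥-elim (X∉ (∈-alphabet⁺ {w} (L⊆w X X∈L))))
            where
            only-∈ : ∀ {X} → X ∈ L → only L m X ≡ markTerm m (bracketL τ w X)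
            only-∈ {X} X∈L with X ∈? L
            ... | yes _   = refl
            ... | no X∉L = ⊥-elim (X∉L X∈L)
            only-∉ : ∀ {X} → X ∉ L → only L m X ≡ []
            only-∉ {X} X∉L with X ∈? L
            ... | yes X∈L = ⊥-elim (X∉L X∈L)
            ... | no _    = refl

      markedSum-invariant : ∀ {u v} → Homotopic τ u v → (Mu : Marking u) (Mv : Marking v) → markedSum Mu ≈ markedSum Mv
      markedSum-invariant h Mu Mv =
        ≈-trans (≈-sym (value-listState Mu))
        (≈-trans (value-homotopy-invariant h (listState Mu) (listState Mv) (listState-pair-free Mv)) (value-listState Mv))

  module _ (invol : ∀ a → τ (τ a) ≡ a) {u v : Nanoword α} (h : Homotopic τ u v) (a : α) where
    open States invol a

    bracket-parity-invariant : τ a ≡ a → (Su : Support τ u a) (Sv : Support τ v a) →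
                               ℤ₂π._≈_ τ (reduce₂ τ (bracketα τ u a Su)) (reduce₂ τ (bracketα τ v a Sv))
    bracket-parity-invariant τa≡a Su Sv =
      ≈-trans (≡⇒∼ (parity-sum Su))
      (≈-trans (markedSum-invariant h (self-dual-marking τa≡a Su) (self-dual-marking τa≡a Sv))
               (≡⇒∼ (sym (parity-sum Sv))))
      where
      open Values Bool false _xor_ true true (λ g → ℤ₂π.≈-trans (ℤ₂π.≈-merge true true g) (ℤ₂π.≈-zero g)) (λ _ → refl)
      parity-sum : ∀ {w} (S : Support τ w a) → reduce₂ τ (bracketα τ w a S) ≡ markedSum (self-dual-marking τa≡a S)
      parity-sum S = trans (sym (map-∘ (letters S))) (sym (++-identityʳ _))

    bracket-difference-invariant : τ a ≢ a → (Su : Support τ u a) (Su′ : Support τ u (τ a))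
                                   (Sv : Support τ v a) (Sv′ : Support τ v (τ a)) →
                                   ℤπ._≈_ τ (_−ℤπ_ τ (bracketα τ u a Su) (bracketα τ u (τ a) Su′))
                                            (_−ℤπ_ τ (bracketα τ v a Sv) (bracketα τ v (τ a) Sv′))
    bracket-difference-invariant τa≢a Su Su′ Sv Sv′ =
      ≈-trans (≡⇒∼ (difference-sum Su Su′))
      (≈-trans (markedSum-invariant h (paired-marking τa≢a Su Su′) (paired-marking τa≢a Sv Sv′))
               (≡⇒∼ (sym (difference-sum Sv Sv′))))
      where
      open Values ℤ (+ 0) ℤ._+_ (+ 1) -[1+ 0 ] (λ g → ℤπ.≈-trans (ℤπ.≈-merge (+ 1) -[1+ 0 ] g) (ℤπ.≈-zero g))
                 (λ τa≡a → ⊥-elim (τa≢a τa≡a))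
      difference-sum : ∀ {w} (S : Support τ w a) (S′ : Support τ w (τ a)) →
                       _−ℤπ_ τ (bracketα τ w a S) (bracketα τ w (τ a) S′) ≡ markedSum (paired-marking τa≢a S S′)
      difference-sum S S′ = cong (bracketα τ _ a S ++_) (sym (map-∘ (letters S′)))

theorem6p1 : {α : Set} (τ : α → α) → (∀ a → τ (τ a) ≡ a) →
    (u v : Nanoword α) → Homotopic τ u v → (a : α) →
      (τ a ≡ a →
        (Su : Support τ u a) (Sv : Support τ v a) →
        ℤ₂π._≈_ τ (reduce₂ τ (bracketα τ u a Su)) (reduce₂ τ (bracketα τ v a Sv)))
      × (τ a ≢ a →
        (Su : Support τ u a) (Su' : Support τ u (τ a))
        (Sv : Support τ v a) (Sv' : Support τ v (τ a)) →
        ℤπ._≈_ τ (_−ℤπ_ τ (bracketα τ u a Su) (bracketα τ u (τ a) Su'))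
                 (_−ℤπ_ τ (bracketα τ v a Sv) (bracketα τ v (τ a) Sv')))
theorem6p1 τ invol u v h a = bracket-parity-invariant τ invol h a , bracket-difference-invariant τ invol h a
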